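{- Let $G$ be an $\{\mathrm{ISK4},\mathrm{wheel}\}$-free trigraph, let $(A,B,C)$ be a good cut-partition of $G$, and for each $X\in\{A,B\}$ let $G_X$ be the $X$-block of $G$ with respect to $(A,B,C)$. Then $G_A$ and $G_B$ are $\{\mathrm{ISK4},\mathrm{wheel}\}$-free.
   Context: A trigraph $G$ consists of a finite set $V(G)$ and a function $\theta_G:\binom{V(G)}{2}\to\{ -1,0,1\}$; for distinct vertices $u,v$ write $uv$ for $\{u,v\}$. The pair $uv$ is strongly adjacent if $\theta_G(uv)=1$, semi-adjacent if $\theta_G(uv)=0$, strongly anti-adjacent if $\theta_G(uv)=-1$; $u,v$ are adjacent if $\theta_G(uv)\ge0$ and anti-adjacent if $\theta_G(uv)\le 0$. A realization of $G$ is any graph on $V(G)$ obtained by turning each semi-adjacent pair into an edge or a non-edge (strongly adjacent pairs being edges, strongly anti-adjacent pairs non-edges); the full realization turns all semi-adjacent pairs into edges. $G[X]$ is the induced subtrigraph on $X$. An ISK4 is a graph isomorphic to a subdivision of $K_4$; a wheel is a graph consisting of a chordless cycle plus a vertex with at least three neighbors on the cycle; $G$ is $\{\mathrm{ISK4},\mathrm{wheel}\}$-free if no realization of $G$ has an induced subgraph that is an ISK4 or a wheel. A stable set (strong clique) is a set of pairwise anti-adjacent (strongly adjacent) vertices. $G\setminus X=G[V(G)\setminus X]$; $G$ is connected if its full realization is connected. A cut-partition of $G$ is a partition $(A,B,C)$ of $V(G)$ with $A,B$ non-empty such that every vertex of $A$ is strongly anti-adjacent to every vertex of $B$. A narrow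 path between $a$ and $b$ is an induced subtrigraph whose full realization is a path with endpoints $a,b$. A good cut-partition is a cut-partition $(A,B,C)$ such that either (type clique) $C$ is a strong clique with $|C|\le 3$ (and $G\setminus C$ disconnected), or (type stable) $C$ is a stable set of size two and each of $G[A\cup C]$, $G[B\cup C]$ contains a narrow path between the two vertices of $C$. For $X\in\{A,B\}$, the $X$-block of $G$ with respect to $(A,B,C)$ is $G[X\cup C]$ if the type is clique, and is the trigraph obtained from $G[X\cup C]$ by making the two vertices of $C$ semi-adjacent if the type is stable. -}

module Defs where

open import Data.Nat using (ℕ; _≤_; _≥_)
open import Data.Bool using (Bool; true; false; T; if_then_else_; _∧_)
open import Data.Fin using (Fin)
open import Data.List using (List; []; _∷_; _++_; [_]; length; concat; filterᵇ; map; take; allFin)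
open import Data.List.Membership.Propositional using (_∈_)
open import Data.List.Relation.Unary.Unique.Propositional using (Unique)
open import Data.Product using (Σ; ∃; _×_; _,_; proj₁; proj₂)
open import Data.Sum using (_⊎_; inj₁; inj₂)
open import Data.Empty using (⊥)
open import Relation.Nullary using (¬_)
open import Relation.Binary.PropositionalEquality using (_≡_; _≢_; refl)
open import Function.Bundles using (_↔_; _⇔_)

-- θ values: -1 (strongly anti-adjacent), 0 (semi-adjacent), 1 (strongly adjacent)
data Trit : Set where
  minus zero plus : Trit

adjᵇ : Trit → Bool
adjᵇ minus = false
adjᵇ zero  = true
adjᵇ plus  = true

antiᵇ : Trit → Bool
antiᵇ minus = true
antiᵇ zero  = true
antiᵇ plus  = false

-- A trigraph on a vertex type V.  θ is only meaningful on pairs of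
-- distinct vertices (its value on the diagonal is irrelevant everywhere).
record Trigraph : Set₁ where
  field
    V     : Set
    θ     : V → V → Trit
    θ-sym : ∀ u v → θ u v ≡ θ v u
open Trigraph public

Finite : Set → Set
Finite V = Σ ℕ λ n → V ↔ Fin n

induced : (G : Trigraph) → (V G → Bool) → Trigraph
induced G X = record
  { V     = Σ (V G) (λ v → T (X v))
  ; θ     = λ u v → θ G (proj₁ u) (proj₁ v)
  ; θ-sym = λ u v → θ-sym G (proj₁ u) (proj₁ v)
  }

record IsSimple {V : Set} (E : V → V → Bool) : Set where
  field
    irrefl : ∀ v → E v v ≡ false
    sym    : ∀ u v → E u v ≡ E v u

record IsRealization (G : Trigraph) (E : V G → V G → Bool) : Set where
  field
    simple    : IsSimple E
    strongAdj : ∀ u v → u ≢ v → θ G u v ≡ plus  → E u v ≡ true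
    strongNon : ∀ u v → u ≢ v → θ G u v ≡ minus → E u v ≡ false

fullAdj : (G : Trigraph) → V G → V G → Set
fullAdj G u v = T (adjᵇ (θ G u v))

Consec : {V : Set} → List V → V → V → Set
Consec xs u v = Σ _ λ ys → Σ _ λ zs → xs ≡ ys ++ (u ∷ v ∷ zs)

Consec± : {V : Set} → List V → V → V → Set
Consec± xs u v = Consec xs u v ⊎ Consec xs v u

k4edge : Fin 6 → Fin 4 × Fin 4
k4edge Fin.zero = (Fin.zero , Fin.suc Fin.zero)
k4edge (Fin.suc Fin.zero) = (Fin.zero , Fin.suc (Fin.suc Fin.zero))
k4edge (Fin.suc (Fin.suc Fin.zero)) = (Fin.zero , Fin.suc (Fin.suc (Fin.suc Fin.zero)))
k4edge (Fin.suc (Fin.suc (Fin.suc Fin.zero))) = (Fin.suc Fin.zero , Fin.suc (Fin.suc Fin.zero))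
k4edge (Fin.suc (Fin.suc (Fin.suc (Fin.suc Fin.zero)))) = (Fin.suc Fin.zero , Fin.suc (Fin.suc (Fin.suc Fin.zero)))
k4edge (Fin.suc (Fin.suc (Fin.suc (Fin.suc (Fin.suc Fin.zero))))) = (Fin.suc (Fin.suc Fin.zero) , Fin.suc (Fin.suc (Fin.suc Fin.zero)))

k4path : {V : Set} → (Fin 4 → V) → Fin 6 → List V → List V
k4path a e ins = a (proj₁ (k4edge e)) ∷ ins ++ [ a (proj₂ (k4edge e)) ]

k4verts : {V : Set} → (Fin 4 → V) → (Fin 6 → List V) → List V
k4verts a ins = map a (allFin 4) ++ concat (map ins (allFin 6))

record ISK4 {V : Set} (E : V → V → Bool) : Set where
  field
    branch   : Fin 4 → V
    inner    : Fin 6 → List V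
    distinct : Unique (k4verts branch inner)
    exact    : ∀ u v → u ∈ k4verts branch inner → v ∈ k4verts branch inner →
               T (E u v) ⇔ (Σ (Fin 6) λ e → Consec± (k4path branch e (inner e)) u v)

-- An induced subgraph of (V, E) which is a wheel: a chordless cycle
-- (listed cyclically as rim) plus a center with at least three neighbours on it.
record Wheel {V : Set} (E : V → V → Bool) : Set where
  field
    center   : V
    rim      : List V
    rimLen   : length rim ≥ 3
    distinct : Unique (center ∷ rim)
    hole     : ∀ u v → u ∈ rim → v ∈ rim →
               T (E u v) ⇔ Consec± (rim ++ take 1 rim) u v
    spokes   : length (filterᵇ (E center) rim) ≥ 3

ISK4WheelFree : Trigraph → Set
ISK4WheelFree G = ∀ (E : V G → V G → Bool) → IsRealization G E → ¬ ISK4 E × ¬ Wheel E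

data Side : Set where
  sA sB sC : Side

record CutPartition (G : Trigraph) : Set where
  field
    part  : V G → Side
    nonA  : Σ (V G) λ v → part v ≡ sA
    nonB  : Σ (V G) λ v → part v ≡ sB
    cutAB : ∀ a b → part a ≡ sA → part b ≡ sB → θ G a b ≡ minus
open CutPartition public

-- narrow path between a and b inside G[X]: an induced subtrigraph of G[X]
-- (given by its vertices listed along the path) whose full realization is a
-- path with ends a and b
record NarrowPath (G : Trigraph) (X : V G → Bool) (a b : V G) : Set where
  field
    verts    : List (V G)
    inX      : ∀ v → v ∈ verts → T (X v)
    inner    : List (V G)
    ends     : verts ≡ a ∷ inner ++ [ b ]
    distinct : Unique verts
    exact    : ∀ u v → u ∈ verts → v ∈ verts → fullAdj G u v ⇔ Consec± verts u v

data Shore : Set where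
  shA shB : Shore

inBlock : Shore → Side → Bool
inBlock shA sA = true
inBlock shA sB = false
inBlock shB sA = false
inBlock shB sB = true
inBlock _   sC = true

record CliqueType {G : Trigraph} (P : CutPartition G) : Set where
  field
    strongClique : ∀ u v → u ≢ v → part P u ≡ sC → part P v ≡ sC → θ G u v ≡ plus
    atMost3      : Σ (List (V G)) λ cs → length cs ≤ 3 × (∀ v → part P v ≡ sC → v ∈ cs)

record StableType {G : Trigraph} (P : CutPartition G) : Set where
  field
    c₁ c₂   : V G
    c₁≢c₂   : c₁ ≢ c₂
    isC     : ∀ v → part P v ≡ sC ⇔ (v ≡ c₁ ⊎ v ≡ c₂)
    stable  : T (antiᵇ (θ G c₁ c₂))
    pathA   : NarrowPath G (λ v → inBlock shA (part P v)) c₁ c₂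
    pathB   : NarrowPath G (λ v → inBlock shB (part P v)) c₁ c₂

record GoodCutPartition (G : Trigraph) : Set where
  field
    cut  : CutPartition G
    type : CliqueType cut ⊎ StableType cut
open GoodCutPartition public

-- make the (unique) pair inside C semi-adjacent
stableθ : Side → Side → Trit → Trit
stableθ sC sC t = zero
stableθ _  _  t = t

stableθ-sym : ∀ s s' t t' → t ≡ t' → stableθ s s' t ≡ stableθ s' s t'
stableθ-sym sA sA t .t refl = refl
stableθ-sym sA sB t .t refl = refl
stableθ-sym sA sC t .t refl = refl
stableθ-sym sB sA t .t refl = refl
stableθ-sym sB sB t .t refl = refl
stableθ-sym sB sC t .t refl = refl
stableθ-sym sC sA t .t refl = refl
stableθ-sym sC sB t .t refl = refl
stableθ-sym sC sC t .t refl = refl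

stableBlock : (G : Trigraph) → CutPartition G → Shore → Trigraph
stableBlock G P X = record
  { V     = Σ (V G) (λ v → T (inBlock X (part P v)))
  ; θ     = λ u v → stableθ (part P (proj₁ u)) (part P (proj₁ v)) (θ G (proj₁ u) (proj₁ v))
  ; θ-sym = λ u v → stableθ-sym (part P (proj₁ u)) (part P (proj₁ v)) _ _ (θ-sym G (proj₁ u) (proj₁ v))
  }

block : (G : Trigraph) → GoodCutPartition G → Shore → Trigraph
block G gp X with type gp
... | inj₁ _ = induced G (λ v → inBlock X (part (cut gp) v))
... | inj₂ _ = stableBlock G (cut gp) X

-- Every realization E of a block G_X is extended to a graph on V(G) by the
-- full realization outside X ∪ C.
--  * Clique type: G_X = G[X ∪ C] is an induced subtrigraph, the extension is
--    a realization of G, and an ISK4 or wheel of E is one of the extension.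
--    So this case is the general fact that induced subtrigraphs of
--    {ISK4, wheel}-free trigraphs are {ISK4, wheel}-free.
--  * Stable type, C = {c₁, c₂}: the only pair where the extension F may fail
--    to be a realization of G is c₁c₂ (semi-adjacent in G_X, possibly
--    strongly anti-adjacent in G).  Let R be F with c₁c₂ set as allowed by G.
--    If F = R we conclude as before.  Otherwise c₁c₂ is an edge of F but not
--    of R, and in R the narrow path Q through the other shore joins c₁ and c₂;
--    its interior is anticomplete to X ∪ C apart from c₁, c₂.  The
--    "edge subdivision" lemma then turns an ISK4 or wheel H of F inside
--    X ∪ C into one of R: replace the edge c₁c₂ of H by Q.  If c₁c₂ is an edge
--    of a branch path of an ISK4, or a rim edge of a wheel, the result is again
--    an ISK4, resp. a wheel.  If c₁ is the centre of a wheel and c₂ a spoke, then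
--    either the wheel keeps three spokes in R, or it had exactly three spokes
--    and the centre, the three spokes, the rim and Q form an ISK4.
module Submission where

open import Defs
open import Data.Nat using (ℕ; suc; _+_; _≤_; _≥_; s≤s; _≤?_)
open import Data.Nat.Properties using (≤-trans; +-suc; m≤m+n; ≰⇒>; ≤-antisym)
open import Data.Bool using (Bool; true; false; T; T?; _∧_)
open import Data.Bool.Properties using (T-irrelevant; ∧-identityʳ; ∧-zeroʳ)
open import Data.Fin as F using (Fin; #_)
open import Data.Fin.Properties using () renaming (_≟_ to _≟F_)
open import Data.List using (List; []; _∷_; _++_; [_]; length; concat; filterᵇ; map; take; allFin; reverse)
open import Data.List.Properties
  using (++-assoc; map-++; reverse-++; unfold-reverse; reverse-involutive; length-map; length-++; ∷-injective; ∷-injectiveʳ; map-∘; concat-map)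
open import Data.List.Membership.Propositional using (_∈_; _∉_)
open import Data.List.Membership.Propositional.Properties using (∈-++⁺ˡ; ∈-++⁺ʳ; ∈-++⁻; ∈-∃++; ∈-map⁻; ∈-map⁺; ∈-allFin)
import Data.List.Membership.DecPropositional as DecMembership
open import Data.List.Relation.Unary.Any using (here; there)
open import Data.List.Relation.Unary.All using ([]; _∷_)
open import Data.List.Relation.Unary.AllPairs using ([]; _∷_)
open import Data.List.Relation.Unary.Unique.Propositional using (Unique)
import Data.List.Relation.Unary.Unique.Propositional.Properties as UniqueP
open UniqueP using () renaming (Unique[x∷xs]⇒x∉xs to head∉tail)
open import Data.List.Relation.Unary.All.Properties using (¬Any⇒All¬)
open import Data.List.Relation.Binary.Permutation.Propositional using (_↭_; ↭-sym; ↭-trans; ↭-prep; ↭-reflexive)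
import Data.List.Relation.Binary.Permutation.Propositional as Perm
import Data.List.Relation.Binary.Permutation.Propositional.Properties as Perm
import Algebra.Solver.CommutativeMonoid as CMSolver
open import Data.Vec using ([]; _∷_)
open import Data.Product using (Σ; _×_; _,_; proj₁; proj₂)
open import Data.Sum using (_⊎_; inj₁; inj₂)
open import Data.Empty using (⊥; ⊥-elim)
open import Data.Unit using (tt)
open import Relation.Nullary using (¬_; Dec; yes; no)
open import Relation.Nullary.Decidable using (via-injection)
open import Relation.Binary.Definitions using (DecidableEquality)
open import Function.Properties.Inverse using (↔⇒↣)
open import Relation.Binary.PropositionalEquality using (_≡_; _≢_; refl; sym; trans; cong; cong₂; subst; module ≡-Reasoning)
open import Function using (_∘_; id)
open import Function.Bundles using (_⇔_; mk⇔; Equivalence)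

T→≡ : ∀ {b} → T b → b ≡ true
T→≡ {true} _ = refl

≡→T : ∀ {b} → b ≡ true → T b
≡→T refl = tt

true≢false : true ≢ false
true≢false ()

-- Adj xs u v: v immediately follows u in xs.  This inductive form of
-- Defs.Consec is the one all the list surgery below is done with.
data Adj {A : Set} : List A → A → A → Set where
  here  : ∀ {u v zs} → Adj (u ∷ v ∷ zs) u v
  there : ∀ {w xs u v} → Adj xs u v → Adj (w ∷ xs) u v

Adj± : {A : Set} → List A → A → A → Set
Adj± xs u v = Adj xs u v ⊎ Adj xs v u

sym± : ∀ {A : Set} {xs : List A} {u v} → Adj± xs u v → Adj± xs v u
sym± (inj₁ p) = inj₂ p
sym± (inj₂ p) = inj₁ p

adj-++ˡ : ∀ {A : Set} (ys : List A) {zs u v} → Adj zs u v → Adj (ys ++ zs) u v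
adj-++ˡ [] p = p
adj-++ˡ (y ∷ ys) p = there (adj-++ˡ ys p)

adj-++ʳ : ∀ {A : Set} {xs : List A} (ys : List A) {u v} → Adj xs u v → Adj (xs ++ ys) u v
adj-++ʳ ys here = here
adj-++ʳ ys (there p) = there (adj-++ʳ ys p)

consec→adj : ∀ {A : Set} {xs : List A} {u v} → Consec xs u v → Adj xs u v
consec→adj (ys , zs , refl) = adj-++ˡ ys here

adj→consec : ∀ {A : Set} {xs : List A} {u v} → Adj xs u v → Consec xs u v
adj→consec {xs = u ∷ v ∷ zs} here = [] , zs , refl
adj→consec {xs = w ∷ xs} (there p) with adj→consec p
... | ys , zs , eq = w ∷ ys , zs , cong (w ∷_) eq

consec±→adj± : ∀ {A : Set} {xs : List A} {u v} → Consec± xs u v → Adj± xs u v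
consec±→adj± (inj₁ c) = inj₁ (consec→adj c)
consec±→adj± (inj₂ c) = inj₂ (consec→adj c)

adj±→consec± : ∀ {A : Set} {xs : List A} {u v} → Adj± xs u v → Consec± xs u v
adj±→consec± (inj₁ c) = inj₁ (adj→consec c)
adj±→consec± (inj₂ c) = inj₂ (adj→consec c)

adj-∈₁ : ∀ {A : Set} {xs : List A} {u v} → Adj xs u v → u ∈ xs
adj-∈₁ here = here refl
adj-∈₁ (there p) = there (adj-∈₁ p)

adj-∈₂ : ∀ {A : Set} {xs : List A} {u v} → Adj xs u v → v ∈ xs
adj-∈₂ here = there (here refl)
adj-∈₂ (there p) = there (adj-∈₂ p)

adj±-∈₁ : ∀ {A : Set} {xs : List A} {u v} → Adj± xs u v → u ∈ xs
adj±-∈₁ (inj₁ p) = adj-∈₁ p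
adj±-∈₁ (inj₂ p) = adj-∈₂ p

adj±-∈₂ : ∀ {A : Set} {xs : List A} {u v} → Adj± xs u v → v ∈ xs
adj±-∈₂ = adj±-∈₁ ∘ sym±

adj-split : ∀ {A : Set} (xs : List A) {b ys u v} → Adj (xs ++ b ∷ ys) u v →
            Adj (xs ++ [ b ]) u v ⊎ Adj (b ∷ ys) u v
adj-split [] p = inj₂ p
adj-split (x ∷ []) here = inj₁ here
adj-split (x ∷ []) (there p) = inj₂ p
adj-split (x ∷ x' ∷ xs) here = inj₁ here
adj-split (x ∷ x' ∷ xs) (there p) with adj-split (x' ∷ xs) p
... | inj₁ q = inj₁ (there q)
... | inj₂ q = inj₂ q

adj-glueˡ : ∀ {A : Set} (xs : List A) {b ys u v} → Adj (xs ++ [ b ]) u v → Adj (xs ++ b ∷ ys) u v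
adj-glueˡ xs {b} {ys} p = subst (λ l → Adj l _ _) (++-assoc xs [ b ] ys) (adj-++ʳ ys p)

adj±-split : ∀ {A : Set} (xs : List A) {b ys u v} → Adj± (xs ++ b ∷ ys) u v →
             Adj± (xs ++ [ b ]) u v ⊎ Adj± (b ∷ ys) u v
adj±-split xs (inj₁ p) with adj-split xs p
... | inj₁ q = inj₁ (inj₁ q)
... | inj₂ q = inj₂ (inj₁ q)
adj±-split xs (inj₂ p) with adj-split xs p
... | inj₁ q = inj₁ (inj₂ q)
... | inj₂ q = inj₂ (inj₂ q)

adj±-glueˡ : ∀ {A : Set} (xs : List A) {b ys u v} → Adj± (xs ++ [ b ]) u v → Adj± (xs ++ b ∷ ys) u v
adj±-glueˡ xs (inj₁ p) = inj₁ (adj-glueˡ xs p)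
adj±-glueˡ xs (inj₂ p) = inj₂ (adj-glueˡ xs p)

adj±-glueʳ : ∀ {A : Set} (xs : List A) {b ys u v} → Adj± (b ∷ ys) u v → Adj± (xs ++ b ∷ ys) u v
adj±-glueʳ xs (inj₁ p) = inj₁ (adj-++ˡ xs p)
adj±-glueʳ xs (inj₂ p) = inj₂ (adj-++ˡ xs p)

adj-init : ∀ {A : Set} (xs : List A) {q u v} → Adj (xs ++ [ q ]) u v → u ∈ xs
adj-init [] (there ())
adj-init (x ∷ []) here = here refl
adj-init (x ∷ []) (there (there ()))
adj-init (x ∷ x' ∷ xs) here = here refl
adj-init (x ∷ x' ∷ xs) (there p) = there (adj-init (x' ∷ xs) p)

adj-interior : ∀ {A : Set} {p q : A} (L : List A) {u v} → Adj (p ∷ L ++ [ q ]) u v →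
               u ∈ L ⊎ v ∈ L ⊎ (L ≡ [] × u ≡ p × v ≡ q)
adj-interior [] here = inj₂ (inj₂ (refl , refl , refl))
adj-interior [] (there (there ()))
adj-interior (l ∷ L) here = inj₂ (inj₁ (here refl))
adj-interior (l ∷ L) (there r) = inj₁ (adj-init (l ∷ L) r)

adj-reverse : ∀ {A : Set} {xs : List A} {u v} → Adj xs u v → Adj (reverse xs) v u
adj-reverse {xs = u ∷ v ∷ zs} here =
  subst (λ l → Adj l v u) (sym (trans (unfold-reverse u (v ∷ zs)) (cong (_++ [ u ]) (unfold-reverse v zs))))
        (subst (λ l → Adj l v u) (sym (++-assoc (reverse zs) [ v ] [ u ])) (adj-++ˡ (reverse zs) here))
adj-reverse {xs = w ∷ xs} (there p) =
  subst (λ l → Adj l _ _) (sym (unfold-reverse w xs)) (adj-++ʳ [ w ] (adj-reverse p))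

adj±-reverse : ∀ {A : Set} {xs : List A} {u v} → Adj± xs u v → Adj± (reverse xs) u v
adj±-reverse (inj₁ p) = inj₂ (adj-reverse p)
adj±-reverse (inj₂ p) = inj₁ (adj-reverse p)

adj±-reverse⁻ : ∀ {A : Set} {xs : List A} {u v} → Adj± (reverse xs) u v → Adj± xs u v
adj±-reverse⁻ {xs = xs} p = subst (λ l → Adj± l _ _) (reverse-involutive xs) (adj±-reverse p)

reverse-path : ∀ {A : Set} (p : A) L q → reverse (p ∷ L ++ [ q ]) ≡ q ∷ reverse L ++ [ p ]
reverse-path p L q = trans (unfold-reverse p (L ++ [ q ])) (cong (_++ [ p ]) (reverse-++ L [ q ]))

path-∈ : ∀ {A : Set} {p q w : A} (L : List A) → w ∈ p ∷ L ++ [ q ] → w ≡ p ⊎ w ∈ L ⊎ w ≡ q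
path-∈ L (here e) = inj₁ e
path-∈ L (there m) with ∈-++⁻ L m
... | inj₁ m' = inj₂ (inj₁ m')
... | inj₂ (here e) = inj₂ (inj₂ e)

∈-tail : ∀ {A : Set} {x w : A} {xs} → x ≢ w → w ∈ x ∷ xs → w ∈ xs
∈-tail n (here e) = ⊥-elim (n (sym e))
∈-tail n (there m) = m

edge-of-two : ∀ {A : Set} {p q u v : A} → Adj± (p ∷ [ q ]) u v → (u ≡ p × v ≡ q) ⊎ (u ≡ q × v ≡ p)
edge-of-two (inj₁ here) = inj₁ (refl , refl)
edge-of-two (inj₁ (there (there ())))
edge-of-two (inj₂ here) = inj₂ (refl , refl)
edge-of-two (inj₂ (there (there ())))

-- Duplicate-freeness is invariant under permutation; most vertex lists
-- below are only known up to a permutation of their pieces.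
unique-↭ : ∀ {A : Set} {xs ys : List A} → xs ↭ ys → Unique xs → Unique ys
unique-↭ Perm.refl u = u
unique-↭ (Perm.prep x p) (h ∷ t) = Perm.All-resp-↭ p h ∷ unique-↭ p t
unique-↭ (Perm.swap x y p) ((x≢y ∷ hx) ∷ (hy ∷ t)) =
  ((λ e → x≢y (sym e)) ∷ Perm.All-resp-↭ p hy) ∷ (Perm.All-resp-↭ p hx ∷ unique-↭ p t)
unique-↭ (Perm.trans p q) u = unique-↭ q (unique-↭ p u)

unique-tail : ∀ {A : Set} {x : A} {xs} → Unique (x ∷ xs) → Unique xs
unique-tail (_ ∷ t) = t

unique-cons : ∀ {A : Set} {x : A} {xs} → x ∉ xs → Unique xs → Unique (x ∷ xs)
unique-cons {xs = xs} n u = ¬Any⇒All¬ xs n ∷ u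

unique-++ : ∀ {A : Set} {xs ys : List A} → Unique xs → Unique ys → (∀ {v} → v ∈ xs → v ∈ ys → ⊥) → Unique (xs ++ ys)
unique-++ ux uy d = UniqueP.++⁺ ux uy (λ (m , n) → d m n)

unique-++⁻ˡ : ∀ {A : Set} (xs : List A) {ys} → Unique (xs ++ ys) → Unique xs
unique-++⁻ˡ [] u = []
unique-++⁻ˡ (x ∷ xs) u = unique-cons (λ m → head∉tail u (∈-++⁺ˡ m)) (unique-++⁻ˡ xs (unique-tail u))

unique-++⁻ʳ : ∀ {A : Set} (xs : List A) {ys} → Unique (xs ++ ys) → Unique ys
unique-++⁻ʳ [] u = u
unique-++⁻ʳ (x ∷ xs) u = unique-++⁻ʳ xs (unique-tail u)

unique-++-disjoint : ∀ {A : Set} (xs : List A) {ys v} → Unique (xs ++ ys) → v ∈ xs → v ∈ ys → ⊥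
unique-++-disjoint (x ∷ xs) u (here refl) m = head∉tail u (∈-++⁺ʳ xs m)
unique-++-disjoint (x ∷ xs) u (there a) m = unique-++-disjoint xs (unique-tail u) a m

adj-distinct : ∀ {A : Set} {xs : List A} {u v} → Unique xs → Adj xs u v → u ≢ v
adj-distinct ((h ∷ _) ∷ _) here e = h e
adj-distinct u (there p) = adj-distinct (unique-tail u) p

adj±-distinct : ∀ {A : Set} {xs : List A} {u v} → Unique xs → Adj± xs u v → u ≢ v
adj±-distinct u (inj₁ p) = adj-distinct u p
adj±-distinct u (inj₂ p) e = adj-distinct u p (sym e)

map-injective-on : ∀ {A B : Set} (f : A → B) xs {x y} → Unique (map f xs) → x ∈ xs → y ∈ xs → f x ≡ f y → x ≡ y
map-injective-on f (z ∷ xs) u (here refl) (here refl) e = refl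
map-injective-on f (z ∷ xs) u (here refl) (there my) e = ⊥-elim (head∉tail u (subst (_∈ map f xs) (sym e) (∈-map⁺ f my)))
map-injective-on f (z ∷ xs) u (there mx) (here refl) e = ⊥-elim (head∉tail u (subst (_∈ map f xs) e (∈-map⁺ f mx)))
map-injective-on f (z ∷ xs) u (there mx) (there my) e = map-injective-on f xs (unique-tail u) mx my e

arc : ∀ {A : Set} → A → List A → A → List A
arc x P y = x ∷ P ++ [ y ]

cycle : ∀ {A : Set} → List A → List A
cycle rim = rim ++ take 1 rim

arcs-split : ∀ {A : Set} (x : A) P y Q {u v} → Adj± (x ∷ P ++ y ∷ Q ++ [ x ]) u v →
             Adj± (arc x P y) u v ⊎ Adj± (arc y Q x) u v
arcs-split x P y Q p = adj±-split (x ∷ P) p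

arcs-glue : ∀ {A : Set} (x : A) P y Q {u v} →
            Adj± (arc x P y) u v ⊎ Adj± (arc y Q x) u v → Adj± (x ∷ P ++ y ∷ Q ++ [ x ]) u v
arcs-glue x P y Q (inj₁ p) = adj±-glueˡ (x ∷ P) p
arcs-glue x P y Q (inj₂ p) = adj±-glueʳ (x ∷ P) p

arcs3-split : ∀ {A : Set} (a b c : A) S1 S2 S3 {u v} → Adj± (a ∷ S1 ++ b ∷ S2 ++ c ∷ S3 ++ [ a ]) u v →
              Adj± (arc a S1 b) u v ⊎ Adj± (arc b S2 c) u v ⊎ Adj± (arc c S3 a) u v
arcs3-split a b c S1 S2 S3 p with adj±-split (a ∷ S1) p
... | inj₁ q = inj₁ q
... | inj₂ q with adj±-split (b ∷ S2) q
...   | inj₁ q' = inj₂ (inj₁ q')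
...   | inj₂ q' = inj₂ (inj₂ q')

arcs3-glue : ∀ {A : Set} (a b c : A) S1 S2 S3 {u v} → Adj± (arc a S1 b) u v ⊎ Adj± (arc b S2 c) u v ⊎ Adj± (arc c S3 a) u v →
             Adj± (a ∷ S1 ++ b ∷ S2 ++ c ∷ S3 ++ [ a ]) u v
arcs3-glue a b c S1 S2 S3 (inj₁ q) = adj±-glueˡ (a ∷ S1) q
arcs3-glue a b c S1 S2 S3 (inj₂ (inj₁ q)) = adj±-glueʳ (a ∷ S1) (adj±-glueˡ (b ∷ S2) q)
arcs3-glue a b c S1 S2 S3 (inj₂ (inj₂ q)) = adj±-glueʳ (a ∷ S1) (adj±-glueʳ (b ∷ S2) q)

swap⊎ : ∀ {X Y : Set} → X ⊎ Y → Y ⊎ X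
swap⊎ (inj₁ x) = inj₂ x
swap⊎ (inj₂ y) = inj₁ y

cycle-rotate : ∀ {A : Set} (S : List A) a M {u v} → Adj± (cycle (S ++ a ∷ M)) u v → Adj± (a ∷ M ++ S ++ [ a ]) u v
cycle-rotate [] a M p = p
cycle-rotate (s ∷ S) a M {u} {v} p =
  arcs-glue a M s S (swap⊎ (arcs-split s S a M (subst (λ l → Adj± (s ∷ l) u v) (++-assoc S (a ∷ M) [ s ]) p)))

cycle-rotate⁻ : ∀ {A : Set} (S : List A) a M {u v} → Adj± (a ∷ M ++ S ++ [ a ]) u v → Adj± (cycle (S ++ a ∷ M)) u v
cycle-rotate⁻ [] a M p = p
cycle-rotate⁻ (s ∷ S) a M {u} {v} p =
  subst (λ l → Adj± (s ∷ l) u v) (sym (++-assoc S (a ∷ M) [ s ])) (arcs-glue s S a M (swap⊎ (arcs-split a M s S p)))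

module ListMonoid {A : Set} = CMSolver (Perm.++-commutativeMonoid {A = A})

adj-snoc : ∀ {A : Set} (L : List A) {q x y} → Adj (L ++ [ q ]) x y → Adj L x y ⊎ (Σ (List A) λ L' → L ≡ L' ++ [ x ] × y ≡ q)
adj-snoc [] (there ())
adj-snoc (l ∷ []) here = inj₂ ([] , refl , refl)
adj-snoc (l ∷ []) (there (there ()))
adj-snoc (l ∷ l' ∷ L) here = inj₁ here
adj-snoc (l ∷ l' ∷ L) (there p) with adj-snoc (l' ∷ L) p
... | inj₁ q = inj₁ (there q)
... | inj₂ (L' , eq , e) = inj₂ (l ∷ L' , cong (l ∷_) eq , e)

CutAt : ∀ {A : Set} → List A → A → A → Set
CutAt {A} rim x y = Σ (List A) λ R' → (rim ↭ arc y R' x) ×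
   (∀ {u v} → Adj± (cycle rim) u v → Adj± (y ∷ R' ++ x ∷ [ y ]) u v) ×
   (∀ {u v} → Adj± (y ∷ R' ++ x ∷ [ y ]) u v → Adj± (cycle rim) u v)

cut-cycle : ∀ {A : Set} (rim : List A) {x y} → length rim ≥ 3 → Adj (cycle rim) x y → CutAt rim x y
cut-cycle (h ∷ t) {x} {y} len p with adj-snoc (h ∷ t) p
... | inj₁ q with adj→consec q
...   | ys , zs , eq = zs ++ ys , prm , fw , bw
  where
  eq' : h ∷ t ≡ (ys ++ [ x ]) ++ y ∷ zs
  eq' = trans eq (sym (++-assoc ys [ x ] (y ∷ zs)))
  eqB : y ∷ zs ++ (ys ++ [ x ]) ++ [ y ] ≡ y ∷ (zs ++ ys) ++ x ∷ [ y ]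
  eqB = cong (y ∷_) (trans (cong (zs ++_) (++-assoc ys [ x ] [ y ])) (sym (++-assoc zs ys (x ∷ [ y ]))))
  fw : ∀ {u v} → Adj± (cycle (h ∷ t)) u v → Adj± (y ∷ (zs ++ ys) ++ x ∷ [ y ]) u v
  fw {u} {v} a = subst (λ l → Adj± l u v) eqB (cycle-rotate (ys ++ [ x ]) y zs (subst (λ l → Adj± (cycle l) u v) eq' a))
  bw : ∀ {u v} → Adj± (y ∷ (zs ++ ys) ++ x ∷ [ y ]) u v → Adj± (cycle (h ∷ t)) u v
  bw {u} {v} a = subst (λ l → Adj± (cycle l) u v) (sym eq') (cycle-rotate⁻ (ys ++ [ x ]) y zs (subst (λ l → Adj± l u v) (sym eqB) a))
  open ListMonoid using (prove; var; _⊕_; Expr)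
  prm : h ∷ t ↭ y ∷ (zs ++ ys) ++ [ x ]
  prm = ↭-trans (↭-reflexive eq)
    (prove 4 (var (# 2) ⊕ (var (# 0) ⊕ (var (# 1) ⊕ var (# 3))))
             (var (# 1) ⊕ ((var (# 3) ⊕ var (# 2)) ⊕ var (# 0)))
             ([ x ] ∷ [ y ] ∷ ys ∷ zs ∷ []))
cut-cycle (h ∷ t) len p | inj₂ ([] , eq , e) with ∷-injectiveʳ eq
... | refl with len
... | s≤s ()
cut-cycle (h ∷ t) {x} {y} len p | inj₂ (l ∷ L' , eq , refl) with ∷-injective eq
... | refl , e2 = L' , ↭-reflexive (cong (h ∷_) e2) , (λ {u} {v} a → subst (λ l → Adj± l u v) eqB a) , (λ {u} {v} a → subst (λ l → Adj± l u v) (sym eqB) a)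
  where
  eqB : h ∷ t ++ [ h ] ≡ h ∷ L' ++ x ∷ [ h ]
  eqB = cong (h ∷_) (trans (cong (_++ [ h ]) e2) (++-assoc L' [ x ] [ h ]))

[]≢++∷ : ∀ {A : Set} (M : List A) {c N} → [] ≡ M ++ c ∷ N → ⊥
[]≢++∷ [] ()
[]≢++∷ (m ∷ M) ()

snoc-split : ∀ {A : Set} (I : List A) q M c N → I ++ [ q ] ≡ M ++ c ∷ N →
             Σ (List A) λ K → I ≡ M ++ K × K ++ [ q ] ≡ c ∷ N
snoc-split I q [] c N e = I , refl , e
snoc-split [] q (m ∷ M) c N e = ⊥-elim ([]≢++∷ M (∷-injectiveʳ e))
snoc-split (i ∷ I) q (m ∷ M) c N e with ∷-injective e
... | refl , e2 with snoc-split I q M c N e2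
... | K , refl , e3 = K , refl , e3

insert-into-edge : ∀ {A : Set} (p q : A) I ys x y zs J → p ∷ I ++ [ q ] ≡ ys ++ x ∷ y ∷ zs →
              Σ (List A) λ I' → (p ∷ I' ++ [ q ] ≡ ys ++ x ∷ J ++ y ∷ zs) × (I' ↭ I ++ J)
insert-into-edge p q I [] x y zs J e with ∷-injective e
... | refl , e2 = J ++ I , cong (p ∷_) (trans (++-assoc J I [ q ]) (cong (J ++_) e2)) , Perm.++-comm J I
insert-into-edge p q I (y0 ∷ ys) x y zs J e with ∷-injective e
... | refl , e2 with snoc-split I q ys x (y ∷ zs) e2
... | [] , _ , e3 = ⊥-elim ([]≢++∷ [] (∷-injectiveʳ e3))
... | k ∷ K2 , refl , e3 with ∷-injective e3
... | refl , e4 = ys ++ x ∷ J ++ K2 , eqn , prm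
  where
  eqn : p ∷ (ys ++ x ∷ J ++ K2) ++ [ q ] ≡ p ∷ ys ++ x ∷ J ++ y ∷ zs
  eqn = cong (p ∷_) (trans (++-assoc ys (x ∷ J ++ K2) [ q ])
          (cong (λ l → ys ++ x ∷ l) (trans (++-assoc J K2 [ q ]) (cong (J ++_) e4))))
  prm : ys ++ x ∷ J ++ K2 ↭ (ys ++ x ∷ K2) ++ J
  prm = ↭-trans (Perm.++⁺ˡ ys (↭-prep x (Perm.++-comm J K2))) (↭-reflexive (sym (++-assoc ys (x ∷ K2) J)))

count : ∀ {A : Set} → (A → Bool) → List A → ℕ
count p xs = length (filterᵇ p xs)

count-++ : ∀ {A : Set} (p : A → Bool) xs ys → count p (xs ++ ys) ≡ count p xs + count p ys
count-++ p [] ys = refl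
count-++ p (x ∷ xs) ys with p x
... | true = cong suc (count-++ p xs ys)
... | false = count-++ p xs ys

count-↭ : ∀ {A : Set} (p : A → Bool) {xs ys} → xs ↭ ys → count p xs ≡ count p ys
count-↭ p q = Perm.↭-length (Perm.filter-↭ (λ v → T? (p v)) q)

count-cong : ∀ {A : Set} (p q : A → Bool) xs → (∀ v → v ∈ xs → p v ≡ q v) → count p xs ≡ count q xs
count-cong p q [] h = refl
count-cong p q (x ∷ xs) h with p x | q x | h x (here refl)
... | true | true | refl = cong suc (count-cong p q xs (λ v m → h v (there m)))
... | false | false | refl = count-cong p q xs (λ v m → h v (there m))

count-map : ∀ {A B : Set} (p : B → Bool) (f : A → B) xs → count p (map f xs) ≡ count (p ∘ f) xs
count-map p f [] = refl
count-map p f (x ∷ xs) with p (f x)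
... | true = cong suc (count-map p f xs)
... | false = count-map p f xs

count-true : ∀ {A : Set} (p : A → Bool) {x} xs → p x ≡ true → count p (x ∷ xs) ≡ suc (count p xs)
count-true p {x} xs e with p x
count-true p xs refl | true = refl

count-false : ∀ {A : Set} (p : A → Bool) {x} xs → p x ≡ false → count p (x ∷ xs) ≡ count p xs
count-false p {x} xs e with p x
count-false p xs refl | false = refl

filter-[] : ∀ {A : Set} (p : A → Bool) xs → filterᵇ p xs ≡ [] → ∀ v → v ∈ xs → p v ≡ false
filter-[] p (x ∷ xs) e v m with p x in eq
filter-[] p (x ∷ xs) () v m | true
filter-[] p (x ∷ xs) e v (here refl) | false = eq
filter-[] p (x ∷ xs) e v (there m) | false = filter-[] p xs e v m

filter-∷ : ∀ {A : Set} (p : A → Bool) xs {w ws} → filterᵇ p xs ≡ w ∷ ws →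
           Σ (List A) λ S → Σ (List A) λ L → xs ≡ S ++ w ∷ L × (∀ v → v ∈ S → p v ≡ false) × p w ≡ true × filterᵇ p L ≡ ws
filter-∷ p (x ∷ xs) e with p x in eq
filter-∷ p (x ∷ xs) refl | true = [] , xs , refl , (λ v ()) , eq , refl
... | false with filter-∷ p xs e
... | S , L , refl , h , pw , fl = x ∷ S , L , refl , falseOn , pw , fl
  where
  falseOn : ∀ v → v ∈ x ∷ S → p v ≡ false
  falseOn v (here refl) = eq
  falseOn v (there m) = h v m

record ThreeMarked {A : Set} (p : A → Bool) (xs : List A) : Set where
  field
    S0 S1 S2 S3 : List A
    a b c : A
    eq : xs ≡ S0 ++ a ∷ S1 ++ b ∷ S2 ++ c ∷ S3
    pa : p a ≡ true
    pb : p b ≡ true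
    pc : p c ≡ true
    only : ∀ v → v ∈ xs → p v ≡ true → v ≡ a ⊎ v ≡ b ⊎ v ≡ c

three-marked : ∀ {A : Set} (p : A → Bool) xs → count p xs ≡ 3 → ThreeMarked p xs
three-marked p xs h with filterᵇ p xs in eqf
three-marked p xs refl | a ∷ b ∷ c ∷ [] with filter-∷ p xs eqf
... | S0 , L1 , refl , h0 , pa , f1 with filter-∷ p L1 f1
... | S1 , L2 , refl , h1 , pb , f2 with filter-∷ p L2 f2
... | S2 , L3 , refl , h2 , pc , f3 = record
  { S0 = S0 ; S1 = S1 ; S2 = S2 ; S3 = L3 ; a = a ; b = b ; c = c ; eq = refl ; pa = pa ; pb = pb ; pc = pc
  ; only = only }
  where
  clash : ∀ {v} → p v ≡ false → p v ≡ true → ⊥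
  clash e1 e2 = true≢false (trans (sym e2) e1)
  only : ∀ v → v ∈ S0 ++ a ∷ S1 ++ b ∷ S2 ++ c ∷ L3 → p v ≡ true → v ≡ a ⊎ v ≡ b ⊎ v ≡ c
  only v m t with ∈-++⁻ S0 m
  ... | inj₁ m0 = ⊥-elim (clash (h0 v m0) t)
  ... | inj₂ (here e) = inj₁ e
  ... | inj₂ (there m1) with ∈-++⁻ S1 m1
  ...   | inj₁ m1' = ⊥-elim (clash (h1 v m1') t)
  ...   | inj₂ (here e) = inj₂ (inj₁ e)
  ...   | inj₂ (there m2) with ∈-++⁻ S2 m2
  ...     | inj₁ m2' = ⊥-elim (clash (h2 v m2') t)
  ...     | inj₂ (here e) = inj₂ (inj₂ e)
  ...     | inj₂ (there m3) = ⊥-elim (clash (filter-[] p L3 f3 v m3) t)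

-- Moving ISK4s and wheels along injective maps

module Transport {A B : Set} (f : A → B) (f-inj : ∀ {x y} → f x ≡ f y → x ≡ y) where

  adj-map : ∀ {xs u v} → Adj xs u v → Adj (map f xs) (f u) (f v)
  adj-map here = here
  adj-map (there p) = there (adj-map p)

  adj-map⁻ : ∀ {xs u v} → Adj (map f xs) (f u) (f v) → Adj xs u v
  adj-map⁻ p = go p refl refl refl
    where
    go : ∀ {ys u' v'} → Adj ys u' v' → ∀ {xs u v} → ys ≡ map f xs → u' ≡ f u → v' ≡ f v → Adj xs u v
    go here {x ∷ y ∷ xs} refl e1 e2 with f-inj e1 | f-inj e2
    ... | refl | refl = here
    go (there p) {x ∷ xs} refl e1 e2 = there (go p refl e1 e2)

  adj±-map : ∀ {xs u v} → Adj± xs u v → Adj± (map f xs) (f u) (f v)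
  adj±-map (inj₁ p) = inj₁ (adj-map p)
  adj±-map (inj₂ p) = inj₂ (adj-map p)

  adj±-map⁻ : ∀ {xs u v} → Adj± (map f xs) (f u) (f v) → Adj± xs u v
  adj±-map⁻ (inj₁ p) = inj₁ (adj-map⁻ p)
  adj±-map⁻ (inj₂ p) = inj₂ (adj-map⁻ p)

  k4verts-map : ∀ (a : Fin 4 → A) (ins : Fin 6 → List A) → k4verts (f ∘ a) (map f ∘ ins) ≡ map f (k4verts a ins)
  k4verts-map a ins = trans (cong₂ _++_ (map-∘ {g = f} {f = a} (allFin 4))
       (trans (cong concat (map-∘ {g = map f} {f = ins} (allFin 6))) (concat-map {f = f} (map ins (allFin 6)))))
     (sym (map-++ f (map a (allFin 4)) (concat (map ins (allFin 6)))))

  k4path-map : ∀ (a : Fin 4 → A) e I → k4path (f ∘ a) e (map f I) ≡ map f (k4path a e I)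
  k4path-map a e I = cong (f (a (proj₁ (k4edge e))) ∷_) (sym (map-++ f I [ a (proj₂ (k4edge e)) ]))

  cycle-map : ∀ xs → cycle (map f xs) ≡ map f (cycle xs)
  cycle-map [] = refl
  cycle-map (x ∷ xs) = cong (f x ∷_) (sym (map-++ f xs [ x ]))

  isk4-map : {E₁ : A → A → Bool} {E₂ : B → B → Bool} (K : ISK4 E₁) →
    (∀ u v → u ∈ k4verts (ISK4.branch K) (ISK4.inner K) → v ∈ k4verts (ISK4.branch K) (ISK4.inner K) → E₂ (f u) (f v) ≡ E₁ u v) →
    ISK4 E₂
  isk4-map {E₁} {E₂} K agree = record
    { branch = f ∘ a ; inner = map f ∘ ins
    ; distinct = subst Unique (sym (k4verts-map a ins)) (UniqueP.map⁺ f-inj (ISK4.distinct K))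
    ; exact = exact }
    where
    a : Fin 4 → A
    a = ISK4.branch K
    ins : Fin 6 → List A
    ins = ISK4.inner K
    exact : ∀ u' v' → u' ∈ k4verts (f ∘ a) (map f ∘ ins) → v' ∈ k4verts (f ∘ a) (map f ∘ ins) →
            T (E₂ u' v') ⇔ (Σ (Fin 6) λ e → Consec± (k4path (f ∘ a) e (map f (ins e))) u' v')
    exact u' v' mu mv with ∈-map⁻ f (subst (u' ∈_) (k4verts-map a ins) mu) | ∈-map⁻ f (subst (v' ∈_) (k4verts-map a ins) mv)
    ... | u , mu' , refl | v , mv' , refl = mk⇔ to from
      where
      old : T (E₁ u v) ⇔ (Σ (Fin 6) λ e → Consec± (k4path a e (ins e)) u v)
      old = ISK4.exact K u v mu' mv'
      to : T (E₂ (f u) (f v)) → Σ (Fin 6) λ e → Consec± (k4path (f ∘ a) e (map f (ins e))) (f u) (f v)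
      to t with Equivalence.to old (subst T (agree u v mu' mv') t)
      ... | e , c = e , adj±→consec± (subst (λ l → Adj± l (f u) (f v)) (sym (k4path-map a e (ins e))) (adj±-map (consec±→adj± c)))
      from : (Σ (Fin 6) λ e → Consec± (k4path (f ∘ a) e (map f (ins e))) (f u) (f v)) → T (E₂ (f u) (f v))
      from (e , c) = subst T (sym (agree u v mu' mv'))
        (Equivalence.from old (e , adj±→consec± (adj±-map⁻ (subst (λ l → Adj± l (f u) (f v)) (k4path-map a e (ins e)) (consec±→adj± c)))))

  wheel-map : {E₁ : A → A → Bool} {E₂ : B → B → Bool} (W : Wheel E₁) →
    (∀ u v → u ∈ Wheel.center W ∷ Wheel.rim W → v ∈ Wheel.center W ∷ Wheel.rim W → E₂ (f u) (f v) ≡ E₁ u v) →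
    Wheel E₂
  wheel-map {E₁} {E₂} W agree = record
    { center = f z ; rim = map f rim
    ; rimLen = subst (_≥ 3) (sym (length-map f rim)) (Wheel.rimLen W)
    ; distinct = UniqueP.map⁺ f-inj (Wheel.distinct W)
    ; hole = hole
    ; spokes = subst (_≥ 3) spokes-eq (Wheel.spokes W) }
    where
    z : A
    z = Wheel.center W
    rim : List A
    rim = Wheel.rim W
    spokes-eq : count (E₁ z) rim ≡ count (E₂ (f z)) (map f rim)
    spokes-eq = trans (count-cong (E₁ z) (E₂ (f z) ∘ f) rim (λ v m → sym (agree z v (here refl) (there m))))
                      (sym (count-map (E₂ (f z)) f rim))
    hole : ∀ u' v' → u' ∈ map f rim → v' ∈ map f rim → T (E₂ u' v') ⇔ Consec± (cycle (map f rim)) u' v'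
    hole u' v' mu mv with ∈-map⁻ f mu | ∈-map⁻ f mv
    ... | u , mu' , refl | v , mv' , refl = mk⇔ to from
      where
      old : T (E₁ u v) ⇔ Consec± (cycle rim) u v
      old = Wheel.hole W u v mu' mv'
      to : T (E₂ (f u) (f v)) → Consec± (cycle (map f rim)) (f u) (f v)
      to t = adj±→consec± (subst (λ l → Adj± l (f u) (f v)) (sym (cycle-map rim))
               (adj±-map (consec±→adj± (Equivalence.to old (subst T (agree u v (there mu') (there mv')) t)))))
      from : Consec± (cycle (map f rim)) (f u) (f v) → T (E₂ (f u) (f v))
      from c = subst T (sym (agree u v (there mu') (there mv')))
        (Equivalence.from old (adj±→consec± (adj±-map⁻ (subst (λ l → Adj± l (f u) (f v)) (cycle-map rim) (consec±→adj± c)))))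

isk4-agree : ∀ {A : Set} {E₁ E₂ : A → A → Bool} (K : ISK4 E₁) →
  (∀ u v → u ∈ k4verts (ISK4.branch K) (ISK4.inner K) → v ∈ k4verts (ISK4.branch K) (ISK4.inner K) → E₂ u v ≡ E₁ u v) →
  ISK4 E₂
isk4-agree = Transport.isk4-map id id

wheel-agree : ∀ {A : Set} {E₁ E₂ : A → A → Bool} (W : Wheel E₁) →
  (∀ u v → u ∈ Wheel.center W ∷ Wheel.rim W → v ∈ Wheel.center W ∷ Wheel.rim W → E₂ u v ≡ E₁ u v) →
  Wheel E₂
wheel-agree = Transport.wheel-map id id

-- The index of the K4 edge joining two branch indices (in either order);
-- it shows that a K4 edge is determined by its ends.
edgeIndex : Fin 4 → Fin 4 → Fin 6
edgeIndex F.zero (F.suc F.zero) = F.zero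
edgeIndex F.zero (F.suc (F.suc F.zero)) = F.suc F.zero
edgeIndex F.zero (F.suc (F.suc (F.suc F.zero))) = F.suc (F.suc F.zero)
edgeIndex (F.suc F.zero) (F.suc (F.suc F.zero)) = F.suc (F.suc (F.suc F.zero))
edgeIndex (F.suc F.zero) (F.suc (F.suc (F.suc F.zero))) = F.suc (F.suc (F.suc (F.suc F.zero)))
edgeIndex (F.suc (F.suc F.zero)) (F.suc (F.suc (F.suc F.zero))) = F.suc (F.suc (F.suc (F.suc (F.suc F.zero))))
edgeIndex (F.suc F.zero) F.zero = F.zero
edgeIndex (F.suc (F.suc F.zero)) F.zero = F.suc F.zero
edgeIndex (F.suc (F.suc (F.suc F.zero))) F.zero = F.suc (F.suc F.zero)
edgeIndex (F.suc (F.suc F.zero)) (F.suc F.zero) = F.suc (F.suc (F.suc F.zero))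
edgeIndex (F.suc (F.suc (F.suc F.zero))) (F.suc F.zero) = F.suc (F.suc (F.suc (F.suc F.zero)))
edgeIndex (F.suc (F.suc (F.suc F.zero))) (F.suc (F.suc F.zero)) = F.suc (F.suc (F.suc (F.suc (F.suc F.zero))))
edgeIndex _ _ = F.zero

edgeIndex-k4edge : ∀ e → edgeIndex (proj₁ (k4edge e)) (proj₂ (k4edge e)) ≡ e
edgeIndex-k4edge F.zero = refl
edgeIndex-k4edge (F.suc F.zero) = refl
edgeIndex-k4edge (F.suc (F.suc F.zero)) = refl
edgeIndex-k4edge (F.suc (F.suc (F.suc F.zero))) = refl
edgeIndex-k4edge (F.suc (F.suc (F.suc (F.suc F.zero)))) = refl
edgeIndex-k4edge (F.suc (F.suc (F.suc (F.suc (F.suc F.zero))))) = refl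

edgeIndex-flip : ∀ e → edgeIndex (proj₂ (k4edge e)) (proj₁ (k4edge e)) ≡ e
edgeIndex-flip F.zero = refl
edgeIndex-flip (F.suc F.zero) = refl
edgeIndex-flip (F.suc (F.suc F.zero)) = refl
edgeIndex-flip (F.suc (F.suc (F.suc F.zero))) = refl
edgeIndex-flip (F.suc (F.suc (F.suc (F.suc F.zero)))) = refl
edgeIndex-flip (F.suc (F.suc (F.suc (F.suc (F.suc F.zero))))) = refl

k4edge-distinct-ends : ∀ e → proj₁ (k4edge e) ≢ proj₂ (k4edge e)
k4edge-distinct-ends F.zero ()
k4edge-distinct-ends (F.suc F.zero) ()
k4edge-distinct-ends (F.suc (F.suc F.zero)) ()
k4edge-distinct-ends (F.suc (F.suc (F.suc F.zero))) ()
k4edge-distinct-ends (F.suc (F.suc (F.suc (F.suc F.zero)))) ()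
k4edge-distinct-ends (F.suc (F.suc (F.suc (F.suc (F.suc F.zero))))) ()

∈-concat-map : ∀ {A : Set} {I : Set} (ins : I → List A) L {e w} → e ∈ L → w ∈ ins e → w ∈ concat (map ins L)
∈-concat-map ins (l ∷ L) (here refl) m = ∈-++⁺ˡ m
∈-concat-map ins (l ∷ L) (there me) m = ∈-++⁺ʳ (ins l) (∈-concat-map ins L me m)

concat-map-injective : ∀ {A : Set} {I : Set} (ins : I → List A) L → Unique L → Unique (concat (map ins L)) →
         ∀ {e e' w} → e ∈ L → e' ∈ L → w ∈ ins e → w ∈ ins e' → e ≡ e'
concat-map-injective ins (l ∷ L) uL uc (here refl) (here refl) m m' = refl
concat-map-injective ins (l ∷ L) uL uc (here refl) (there me') m m' = ⊥-elim (unique-++-disjoint (ins l) uc m (∈-concat-map ins L me' m'))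
concat-map-injective ins (l ∷ L) uL uc (there me) (here refl) m m' = ⊥-elim (unique-++-disjoint (ins l) uc m' (∈-concat-map ins L me m))
concat-map-injective ins (l ∷ L) uL uc (there me) (there me') m m' = concat-map-injective ins L (unique-tail uL) (unique-++⁻ʳ (ins l) uc) me me' m m'

concat-map-unique : ∀ {A : Set} {I : Set} (ins : I → List A) L → Unique (concat (map ins L)) → ∀ {e} → e ∈ L → Unique (ins e)
concat-map-unique ins (l ∷ L) uc (here refl) = unique-++⁻ˡ (ins l) uc
concat-map-unique ins (l ∷ L) uc (there me) = concat-map-unique ins L (unique-++⁻ʳ (ins l) uc) me

module K4Structure {A : Set} (a : Fin 4 → A) (ins : Fin 6 → List A) (UK : Unique (k4verts a ins)) where

  UB : Unique (map a (allFin 4))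
  UB = unique-++⁻ˡ (map a (allFin 4)) UK

  UC : Unique (concat (map ins (allFin 6)))
  UC = unique-++⁻ʳ (map a (allFin 4)) UK

  a-inj : ∀ {i j} → a i ≡ a j → i ≡ j
  a-inj {i} {j} e = map-injective-on a (allFin 4) UB (∈-allFin i) (∈-allFin j) e

  br∈ : ∀ i → a i ∈ k4verts a ins
  br∈ i = ∈-++⁺ˡ (∈-map⁺ a (∈-allFin i))

  in∈ : ∀ e {w} → w ∈ ins e → w ∈ k4verts a ins
  in∈ e m = ∈-++⁺ʳ (map a (allFin 4)) (∈-concat-map ins (allFin 6) (∈-allFin e) m)

  br∉ : ∀ i e → a i ∈ ins e → ⊥
  br∉ i e m = unique-++-disjoint (map a (allFin 4)) UK (∈-map⁺ a (∈-allFin i)) (∈-concat-map ins (allFin 6) (∈-allFin e) m)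

  in-inj : ∀ {e e' w} → w ∈ ins e → w ∈ ins e' → e ≡ e'
  in-inj {e} {e'} m m' = concat-map-injective ins (allFin 6) (UniqueP.allFin⁺ 6) UC (∈-allFin e) (∈-allFin e') m m'

  path∈ : ∀ e {w} → w ∈ k4path a e (ins e) → w ∈ k4verts a ins
  path∈ e (here refl) = br∈ _
  path∈ e (there m) with ∈-++⁻ (ins e) m
  ... | inj₁ m' = in∈ e m'
  ... | inj₂ (here refl) = br∈ _

  path-uniq : ∀ e → Unique (k4path a e (ins e))
  path-uniq e = unique-cons n1 (unique-++ (concat-map-unique ins (allFin 6) UC (∈-allFin e)) ([] ∷ []) d)
    where
    s t : Fin 4
    s = proj₁ (k4edge e)
    t = proj₂ (k4edge e)
    d : ∀ {v} → v ∈ ins e → v ∈ [ a t ] → ⊥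
    d m (here refl) = br∉ t e m
    n1 : a s ∈ ins e ++ [ a t ] → ⊥
    n1 m with ∈-++⁻ (ins e) m
    ... | inj₁ m' = br∉ s e m'
    ... | inj₂ (here eq) = k4edge-distinct-ends e (a-inj eq)

  inner-on : ∀ {e e' w} → w ∈ ins e → w ∈ k4path a e' (ins e') → e ≡ e'
  inner-on {e} {e'} m m' with path-∈ (ins e') m'
  ... | inj₁ refl = ⊥-elim (br∉ _ e m)
  ... | inj₂ (inj₁ m'') = in-inj m m''
  ... | inj₂ (inj₂ refl) = ⊥-elim (br∉ _ e m)

  adj-interior± : ∀ e {u v} → Adj± (k4path a e (ins e)) u v →
    u ∈ ins e ⊎ v ∈ ins e ⊎ ((u ≡ a (proj₁ (k4edge e)) × v ≡ a (proj₂ (k4edge e))) ⊎ (v ≡ a (proj₁ (k4edge e)) × u ≡ a (proj₂ (k4edge e))))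
  adj-interior± e (inj₁ p) with adj-interior (ins e) p
  ... | inj₁ m = inj₁ m
  ... | inj₂ (inj₁ m) = inj₂ (inj₁ m)
  ... | inj₂ (inj₂ (_ , e1 , e2)) = inj₂ (inj₂ (inj₁ (e1 , e2)))
  adj-interior± e (inj₂ p) with adj-interior (ins e) p
  ... | inj₁ m = inj₂ (inj₁ m)
  ... | inj₂ (inj₁ m) = inj₁ m
  ... | inj₂ (inj₂ (_ , e1 , e2)) = inj₂ (inj₂ (inj₂ (e1 , e2)))

  edge-uniq : ∀ {e e' u v} → Adj± (k4path a e (ins e)) u v → Adj± (k4path a e' (ins e')) u v → e ≡ e'
  edge-uniq {e} {e'} {u} {v} p p' with adj-interior± e p
  ... | inj₁ m = inner-on m (adj±-∈₁ p')
  ... | inj₂ (inj₁ m) = inner-on m (adj±-∈₂ p')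
  ... | inj₂ (inj₂ ends) with adj-interior± e' p'
  ...   | inj₁ m = sym (inner-on m (adj±-∈₁ p))
  ...   | inj₂ (inj₁ m) = sym (inner-on m (adj±-∈₂ p))
  ...   | inj₂ (inj₂ ends') = fin ends ends'
    where
    s t s' t' : Fin 4
    s = proj₁ (k4edge e)
    t = proj₂ (k4edge e)
    s' = proj₁ (k4edge e')
    t' = proj₂ (k4edge e')
    fin : ((u ≡ a s × v ≡ a t) ⊎ (v ≡ a s × u ≡ a t)) → ((u ≡ a s' × v ≡ a t') ⊎ (v ≡ a s' × u ≡ a t')) → e ≡ e'
    fin (inj₁ (refl , refl)) (inj₁ (q1 , q2)) =
      trans (sym (edgeIndex-k4edge e)) (trans (cong₂ edgeIndex (a-inj q1) (a-inj q2)) (edgeIndex-k4edge e'))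
    fin (inj₁ (refl , refl)) (inj₂ (q1 , q2)) =
      trans (sym (edgeIndex-k4edge e)) (trans (cong₂ edgeIndex (a-inj q2) (a-inj q1)) (edgeIndex-flip e'))
    fin (inj₂ (refl , refl)) (inj₁ (q1 , q2)) =
      trans (sym (edgeIndex-flip e)) (trans (cong₂ edgeIndex (a-inj q1) (a-inj q2)) (edgeIndex-k4edge e'))
    fin (inj₂ (refl , refl)) (inj₂ (q1 , q2)) =
      trans (sym (edgeIndex-k4edge e)) (trans (cong₂ edgeIndex (a-inj q1) (a-inj q2)) (edgeIndex-k4edge e'))

-- Subdividing an edge by a bypass

IsPair : ∀ {W : Set} → W → W → W → W → Set
IsPair c₁ c₂ u v = (u ≡ c₁ × v ≡ c₂) ⊎ (u ≡ c₂ × v ≡ c₁)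

module EdgeSubdivision {W : Set} (_≟_ : DecidableEquality W)
  (F R : W → W → Bool) (Fs : IsSimple F) (Rs : IsSimple R)
  (c1 c2 : W) (c1≢c2 : c1 ≢ c2) (Fc : F c1 c2 ≡ true) (Rc : R c1 c2 ≡ false)
  (agreeFR : ∀ u v → ¬ IsPair c1 c2 u v → F u v ≡ R u v)
  (inS : W → Set)
  (I : List W) (Quniq : Unique (c1 ∷ I ++ [ c2 ]))
  (Inot : ∀ p → p ∈ I → ¬ inS p)
  (Ianti : ∀ p v → p ∈ I → inS v → v ≢ c1 → v ≢ c2 → R p v ≡ false)
  (Qto : ∀ u v → u ∈ c1 ∷ I ++ [ c2 ] → v ∈ c1 ∷ I ++ [ c2 ] → R u v ≡ true → Adj± (c1 ∷ I ++ [ c2 ]) u v)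
  (Qfrom : ∀ u v → Adj± (c1 ∷ I ++ [ c2 ]) u v → R u v ≡ true)
  where

  CPair : W → W → Set
  CPair = IsPair c1 c2

  Rsym : ∀ u v → R u v ≡ R v u
  Rsym = IsSimple.sym Rs

  Fsym : ∀ u v → F u v ≡ F v u
  Fsym = IsSimple.sym Fs

  pair-sym : ∀ {x y} → CPair x y → CPair y x
  pair-sym (inj₁ (a , b)) = inj₂ (b , a)
  pair-sym (inj₂ (a , b)) = inj₁ (b , a)

  pair-distinct : ∀ {x y} → CPair x y → x ≢ y
  pair-distinct (inj₁ (refl , refl)) = c1≢c2
  pair-distinct (inj₂ (refl , refl)) e = c1≢c2 (sym e)

  pair-avoid : ∀ {x y w} → CPair x y → w ≢ x → w ≢ y → w ≢ c1 × w ≢ c2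
  pair-avoid (inj₁ (refl , refl)) a b = a , b
  pair-avoid (inj₂ (refl , refl)) a b = b , a

  pair-cases : ∀ {x y u v} → CPair x y → CPair u v → (u ≡ x × v ≡ y) ⊎ (u ≡ y × v ≡ x)
  pair-cases (inj₁ (refl , refl)) (inj₁ (refl , refl)) = inj₁ (refl , refl)
  pair-cases (inj₁ (refl , refl)) (inj₂ (refl , refl)) = inj₂ (refl , refl)
  pair-cases (inj₂ (refl , refl)) (inj₁ (refl , refl)) = inj₂ (refl , refl)
  pair-cases (inj₂ (refl , refl)) (inj₂ (refl , refl)) = inj₁ (refl , refl)

  pair-edge : ∀ {x y u v} → CPair x y → Adj± (x ∷ [ y ]) u v → CPair u v
  pair-edge p e with edge-of-two e
  ... | inj₁ (refl , refl) = p
  ... | inj₂ (refl , refl) = pair-sym p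

  R-pair-false : ∀ {x y} → CPair x y → R x y ≡ false
  R-pair-false (inj₁ (refl , refl)) = Rc
  R-pair-false (inj₂ (refl , refl)) = trans (Rsym c2 c1) Rc

  F-pair-true : ∀ {x y} → CPair x y → F x y ≡ true
  F-pair-true (inj₁ (refl , refl)) = Fc
  F-pair-true (inj₂ (refl , refl)) = trans (Fsym c2 c1) Fc

  R-true→¬pair : ∀ {u v} → R u v ≡ true → ¬ CPair u v
  R-true→¬pair r p = true≢false (trans (sym r) (R-pair-false p))

  F→R : ∀ {u v} → F u v ≡ true → ¬ CPair u v → R u v ≡ true
  F→R {u} {v} f np = trans (sym (agreeFR u v np)) f

  R→F : ∀ {u v} → R u v ≡ true → F u v ≡ true
  R→F {u} {v} r = trans (agreeFR u v (R-true→¬pair r)) r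

  open DecMembership _≟_ using (_∈?_)

  meets-pair : ∀ (xs : List W) → (∀ u v → u ∈ xs → v ∈ xs → ¬ CPair u v) ⊎ (c1 ∈ xs × c2 ∈ xs)
  meets-pair xs with c1 ∈? xs | c2 ∈? xs
  ... | yes a | yes b = inj₂ (a , b)
  ... | no a | _ = inj₁ λ { u v mu mv (inj₁ (refl , refl)) → a mu ; u v mu mv (inj₂ (refl , refl)) → a mv }
  ... | _ | no b = inj₁ λ { u v mu mv (inj₁ (refl , refl)) → b mv ; u v mu mv (inj₂ (refl , refl)) → b mu }

  record Bypass (x y : W) : Set where
    field
      J : List W
      uq : Unique (x ∷ J ++ [ y ])
      Jnot : ∀ p → p ∈ J → ¬ inS p
      Janti : ∀ p v → p ∈ J → inS v → v ≢ c1 → v ≢ c2 → R p v ≡ false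
      to : ∀ u v → u ∈ x ∷ J ++ [ y ] → v ∈ x ∷ J ++ [ y ] → R u v ≡ true → Adj± (x ∷ J ++ [ y ]) u v
      from : ∀ u v → Adj± (x ∷ J ++ [ y ]) u v → R u v ≡ true

    J-unique : Unique J
    J-unique = unique-++⁻ˡ J (unique-tail uq)

  bypass : ∀ {x y} → CPair x y → Bypass x y
  bypass (inj₁ (refl , refl)) = record { J = I ; uq = Quniq ; Jnot = Inot ; Janti = Ianti ; to = Qto ; from = Qfrom }
  bypass (inj₂ (refl , refl)) = record
    { J = reverse I
    ; uq = subst Unique eqr (unique-↭ (↭-sym (Perm.↭-reverse L)) Quniq)
    ; Jnot = λ p m → Inot p (Perm.∈-resp-↭ (Perm.↭-reverse I) m)
    ; Janti = λ p v m → Ianti p v (Perm.∈-resp-↭ (Perm.↭-reverse I) m)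
    ; to = λ u v mu mv r → subst (λ l → Adj± l u v) eqr (adj±-reverse (Qto u v (back mu) (back mv) r))
    ; from = λ u v a → Qfrom u v (adj±-reverse⁻ (subst (λ l → Adj± l u v) (sym eqr) a)) }
    where
    L : List W
    L = c1 ∷ I ++ [ c2 ]
    eqr : reverse L ≡ c2 ∷ reverse I ++ [ c1 ]
    eqr = reverse-path c1 I c2
    back : ∀ {w} → w ∈ c2 ∷ reverse I ++ [ c1 ] → w ∈ L
    back m = Perm.∈-resp-↭ (Perm.↭-reverse L) (subst (_ ∈_) (sym eqr) m)

  module UseBypass {x y} (Pxy : CPair x y) (O : Bypass x y) where
    open Bypass O
    bypass-edge : ∀ p w → p ∈ J → (inS w ⊎ w ∈ J) → R p w ≡ true → Adj± (x ∷ J ++ [ y ]) p w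
    bypass-edge p w m (inj₂ mw) r = to p w (there (∈-++⁺ˡ m)) (there (∈-++⁺ˡ mw)) r
    bypass-edge p w m (inj₁ sw) r with w ≟ x | w ≟ y
    ... | yes refl | _ = to p w (there (∈-++⁺ˡ m)) (here refl) r
    ... | _ | yes refl = to p w (there (∈-++⁺ˡ m)) (there (∈-++⁺ʳ J (here refl))) r
    ... | no nx | no ny = ⊥-elim (true≢false (trans (sym r)
             (Janti p w m sw (proj₁ (pair-avoid Pxy nx ny)) (proj₂ (pair-avoid Pxy nx ny)))))

  -- An ISK4 of F whose branch path e0 contains the edge xy = c1c2 becomes
  -- an ISK4 of R with the same branch vertices: the edge xy of path e0 is
  -- replaced by the bypass x ∷ J ++ [ y ].
  module SubdivideBranch (K : ISK4 F) (inSK : ∀ v → v ∈ k4verts (ISK4.branch K) (ISK4.inner K) → inS v)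
                (e0 : Fin 6) {x y : W} (Pxy : CPair x y)
                (adj0 : Adj (k4path (ISK4.branch K) e0 (ISK4.inner K e0)) x y) where
    a : Fin 4 → W
    a = ISK4.branch K
    ins : Fin 6 → List W
    ins = ISK4.inner K
    open K4Structure a ins (ISK4.distinct K)
    O : Bypass x y
    O = bypass Pxy
    open Bypass O
    open UseBypass Pxy O
    s t : Fin 4
    s = proj₁ (k4edge e0)
    t = proj₂ (k4edge e0)
    cons0 : Consec (k4path a e0 (ins e0)) x y
    cons0 = adj→consec adj0
    ys zs : List W
    ys = proj₁ cons0
    zs = proj₁ (proj₂ cons0)
    eqL0 : k4path a e0 (ins e0) ≡ ys ++ x ∷ y ∷ zs
    eqL0 = proj₂ (proj₂ cons0)
    spl : Σ (List W) λ I' → (a s ∷ I' ++ [ a t ] ≡ ys ++ x ∷ J ++ y ∷ zs) × (I' ↭ ins e0 ++ J)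
    spl = insert-into-edge (a s) (a t) (ins e0) ys x y zs J eqL0
    I' : List W
    I' = proj₁ spl
    eqL0' : a s ∷ I' ++ [ a t ] ≡ ys ++ x ∷ J ++ y ∷ zs
    eqL0' = proj₁ (proj₂ spl)
    perm0 : I' ↭ ins e0 ++ J
    perm0 = proj₂ (proj₂ spl)

    ins' : Fin 6 → List W
    ins' e with e ≟F e0
    ... | yes _ = I'
    ... | no _ = ins e
    ins'-e0 : ins' e0 ≡ I'
    ins'-e0 with e0 ≟F e0
    ... | yes _ = refl
    ... | no n = ⊥-elim (n refl)
    ins'-ne : ∀ e → e ≢ e0 → ins' e ≡ ins e
    ins'-ne e n with e ≟F e0
    ... | yes p = ⊥-elim (n p)
    ... | no _ = refl

    interiors-unchanged : ∀ L → e0 ∉ L → concat (map ins' L) ≡ concat (map ins L)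
    interiors-unchanged [] n = refl
    interiors-unchanged (l ∷ L) n = cong₂ _++_ (ins'-ne l (λ e → n (here (sym e)))) (interiors-unchanged L (λ m → n (there m)))

    interiors-grow : ∀ L → Unique L → e0 ∈ L → concat (map ins' L) ↭ concat (map ins L) ++ J
    interiors-grow (l ∷ L) u (here refl) rewrite ins'-e0 | interiors-unchanged L (head∉tail u) =
      ↭-trans (Perm.++⁺ʳ C perm0) (↭-trans (↭-reflexive (++-assoc (ins e0) J C))
        (↭-trans (Perm.++⁺ˡ (ins e0) (Perm.++-comm J C)) (↭-reflexive (sym (++-assoc (ins e0) C J)))))
      where C = concat (map ins L)
    interiors-grow (l ∷ L) u (there m) rewrite ins'-ne l (λ e → head∉tail u (subst (_∈ L) (sym e) m)) =
      ↭-trans (Perm.++⁺ˡ (ins l) (interiors-grow L (unique-tail u) m)) (↭-reflexive (sym (++-assoc (ins l) (concat (map ins L)) J)))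

    kv'↭ : k4verts a ins' ↭ k4verts a ins ++ J
    kv'↭ = ↭-trans (Perm.++⁺ˡ (map a (allFin 4)) (interiors-grow (allFin 6) (UniqueP.allFin⁺ 6) (∈-allFin e0)))
                   (↭-reflexive (sym (++-assoc (map a (allFin 4)) (concat (map ins (allFin 6))) J)))

    mem' : ∀ {w} → w ∈ k4verts a ins' → w ∈ k4verts a ins ⊎ w ∈ J
    mem' m = ∈-++⁻ (k4verts a ins) (Perm.∈-resp-↭ kv'↭ m)

    -- J is disjoint from the old vertices, which lie in inS
    uniq' : Unique (k4verts a ins')
    uniq' = unique-↭ (↭-sym kv'↭) (unique-++ (ISK4.distinct K) J-unique (λ {v} m mj → Jnot v mj (inSK v m)))

    P-ne : ∀ e → e ≢ e0 → k4path a e (ins' e) ≡ k4path a e (ins e)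
    P-ne e n = cong (λ l → a (proj₁ (k4edge e)) ∷ l ++ [ a (proj₂ (k4edge e)) ]) (ins'-ne e n)

    P-e0 : k4path a e0 (ins' e0) ≡ ys ++ x ∷ J ++ y ∷ zs
    P-e0 = trans (cong (λ l → a s ∷ l ++ [ a t ]) ins'-e0) eqL0'

    UL0 : Unique (ys ++ x ∷ y ∷ zs)
    UL0 = subst Unique eqL0 (path-uniq e0)

    y∉ys-x : y ∈ ys ++ [ x ] → ⊥
    y∉ys-x m with ∈-++⁻ ys m
    ... | inj₁ m' = unique-++-disjoint ys UL0 m' (there (here refl))
    ... | inj₂ (here e) = pair-distinct Pxy (sym e)

    x∉y-zs : x ∈ y ∷ zs → ⊥
    x∉y-zs (here e) = pair-distinct Pxy e
    x∉y-zs (there m) = head∉tail (unique-++⁻ʳ ys UL0) (there m)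

    notPair-ysx : ∀ {u v} → Adj± (ys ++ [ x ]) u v → ¬ CPair u v
    notPair-ysx p pr with pair-cases Pxy pr
    ... | inj₁ (refl , refl) = y∉ys-x (adj±-∈₂ p)
    ... | inj₂ (refl , refl) = y∉ys-x (adj±-∈₁ p)

    notPair-yzs : ∀ {u v} → Adj± (y ∷ zs) u v → ¬ CPair u v
    notPair-yzs p pr with pair-cases Pxy pr
    ... | inj₁ (refl , refl) = x∉y-zs (adj±-∈₁ p)
    ... | inj₂ (refl , refl) = x∉y-zs (adj±-∈₂ p)

    F-on-old-path : ∀ e {u v} → Adj± (k4path a e (ins e)) u v → F u v ≡ true
    F-on-old-path e {u} {v} p = T→≡ (Equivalence.from (ISK4.exact K u v (path∈ e (adj±-∈₁ p)) (path∈ e (adj±-∈₂ p))) (e , adj±→consec± p))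

    L0adj : Adj± (k4path a e0 (ins e0)) x y
    L0adj = inj₁ adj0

    fromP : ∀ u v e → Adj± (k4path a e (ins' e)) u v → R u v ≡ true
    fromP u v e p with e ≟F e0
    ... | no n = F→R (F-on-old-path e p) np
      where
      np : ¬ CPair u v
      np pr with pair-cases Pxy pr
      ... | inj₁ (refl , refl) = n (edge-uniq p L0adj)
      ... | inj₂ (refl , refl) = n (edge-uniq (sym± p) L0adj)
    ... | yes refl with adj±-split ys (subst (λ l → Adj± l u v) eqL0' p)
    ...   | inj₁ q = F→R (F-on-old-path e0 (subst (λ l → Adj± l u v) (sym eqL0) (adj±-glueˡ ys q))) (notPair-ysx q)
    ...   | inj₂ q with adj±-split (x ∷ J) q
    ...     | inj₁ q' = from u v q'
    ...     | inj₂ q' = F→R (F-on-old-path e0 (subst (λ l → Adj± l u v) (sym eqL0) (adj±-glueʳ ys (adj±-glueʳ (x ∷ []) q')))) (notPair-yzs q')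

    embedQ : ∀ {u v} → Adj± (x ∷ J ++ [ y ]) u v → Adj± (k4path a e0 (ins' e0)) u v
    embedQ {u} {v} q = subst (λ l → Adj± l u v) (sym P-e0) (adj±-glueʳ ys (adj±-glueˡ (x ∷ J) q))

    side : ∀ {w} → w ∈ k4verts a ins ⊎ w ∈ J → inS w ⊎ w ∈ J
    side (inj₁ m) = inj₁ (inSK _ m)
    side (inj₂ m) = inj₂ m

    toP : ∀ u v → u ∈ k4verts a ins' → v ∈ k4verts a ins' → R u v ≡ true → Σ (Fin 6) λ e → Adj± (k4path a e (ins' e)) u v
    toP u v mu mv r with mem' mu | mem' mv
    ... | inj₂ ju | mv' = e0 , embedQ (bypass-edge u v ju (side mv') r)
    ... | inj₁ ou | inj₂ jv = e0 , embedQ (sym± (bypass-edge v u jv (inj₁ (inSK u ou)) (trans (Rsym v u) r)))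
    ... | inj₁ ou | inj₁ ov with Equivalence.to (ISK4.exact K u v ou ov) (≡→T (R→F r))
    ...   | e , c with e ≟F e0
    ...     | no n = e , subst (λ l → Adj± l u v) (sym (P-ne e n)) (consec±→adj± c)
    ...     | yes refl with adj±-split ys (subst (λ l → Adj± l u v) eqL0 (consec±→adj± c))
    ...       | inj₁ q = e0 , subst (λ l → Adj± l u v) (sym P-e0) (adj±-glueˡ ys q)
    ...       | inj₂ q with adj±-split (x ∷ []) q
    ...         | inj₁ q' = ⊥-elim (R-true→¬pair r (pair-edge Pxy q'))
    ...         | inj₂ q' = e0 , subst (λ l → Adj± l u v) (sym P-e0) (adj±-glueʳ ys (adj±-glueʳ (x ∷ J) q'))

    result : ISK4 R
    result = record
      { branch = a ; inner = ins' ; distinct = uniq'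
      ; exact = λ u v mu mv → mk⇔ (λ tt' → let r = toP u v mu mv (T→≡ tt') in proj₁ r , adj±→consec± (proj₂ r))
                                    (λ ec → ≡→T (fromP u v (proj₁ ec) (consec±→adj± (proj₂ ec)))) }

  isk4-subdivide : (K : ISK4 F) → (∀ v → v ∈ k4verts (ISK4.branch K) (ISK4.inner K) → inS v) → ISK4 R
  isk4-subdivide K inSK with meets-pair (k4verts (ISK4.branch K) (ISK4.inner K))
  ... | inj₁ np = isk4-agree K (λ u v mu mv → sym (agreeFR u v (np u v mu mv)))
  ... | inj₂ (m1 , m2) with Equivalence.to (ISK4.exact K c1 c2 m1 m2) (≡→T Fc)
  ...   | e0 , c with consec±→adj± c
  ...     | inj₁ p = SubdivideBranch.result K inSK e0 (inj₁ (refl , refl)) p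
  ...     | inj₂ p = SubdivideBranch.result K inSK e0 (inj₂ (refl , refl)) p

  -- A wheel of F whose rim contains the edge xy = c1c2 (and whose centre is
  -- neither x nor y) becomes a wheel of R with the same centre: the rim
  -- edge xy is replaced by the bypass.  The rim grows and no spoke is lost.
  module SubdivideRim (Wh : Wheel F) (inSW : ∀ v → v ∈ Wheel.center Wh ∷ Wheel.rim Wh → inS v)
                 {x y : W} (Pxy : CPair x y) (zx : Wheel.center Wh ≢ x) (zy : Wheel.center Wh ≢ y)
                 (adj0 : Adj (cycle (Wheel.rim Wh)) x y) where
    z : W
    z = Wheel.center Wh
    rim : List W
    rim = Wheel.rim Wh
    UR0 : Unique (z ∷ rim)
    UR0 = Wheel.distinct Wh
    O : Bypass x y
    O = bypass Pxy
    open Bypass O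
    open UseBypass Pxy O

    sp : CutAt rim x y
    sp = cut-cycle rim (Wheel.rimLen Wh) adj0
    R' : List W
    R' = proj₁ sp
    prm : rim ↭ y ∷ R' ++ [ x ]
    prm = proj₁ (proj₂ sp)
    fw : ∀ {u v} → Adj± (cycle rim) u v → Adj± (y ∷ R' ++ x ∷ [ y ]) u v
    fw = proj₁ (proj₂ (proj₂ sp))
    bw : ∀ {u v} → Adj± (y ∷ R' ++ x ∷ [ y ]) u v → Adj± (cycle rim) u v
    bw = proj₂ (proj₂ (proj₂ sp))

    Uarc : Unique (y ∷ R' ++ [ x ])
    Uarc = unique-↭ prm (unique-tail UR0)
    x∉R' : x ∈ R' → ⊥
    x∉R' m = unique-++-disjoint R' (unique-tail Uarc) m (here refl)
    y∉R' : y ∈ R' → ⊥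
    y∉R' m = head∉tail Uarc (∈-++⁺ˡ m)
    R'ne : R' ≡ [] → ⊥
    R'ne e with subst (3 ≤_) (Perm.↭-length prm) (Wheel.rimLen Wh)
    ... | le rewrite e with le
    ... | s≤s (s≤s ())

    N : List W
    N = y ∷ R' ++ x ∷ J
    cycN : cycle N ≡ y ∷ R' ++ x ∷ J ++ [ y ]
    cycN = cong (y ∷_) (++-assoc R' (x ∷ J) [ y ])
    Nperm : N ↭ rim ++ J
    Nperm = ↭-trans (↭-reflexive (cong (y ∷_) (sym (++-assoc R' [ x ] J)))) (Perm.++⁺ʳ J (↭-sym prm))
    memN : ∀ {w} → w ∈ N → w ∈ rim ⊎ w ∈ J
    memN m = ∈-++⁻ rim (Perm.∈-resp-↭ Nperm m)
    UN : Unique (z ∷ N)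
    UN = unique-↭ (↭-sym (↭-prep z Nperm)) (unique-++ UR0 J-unique d)
      where
      d : ∀ {v} → v ∈ z ∷ rim → v ∈ J → ⊥
      d m mj = Jnot _ mj (inSW _ m)

    arcR∈ : ∀ {w} → w ∈ arc y R' x → w ∈ rim
    arcR∈ m = Perm.∈-resp-↭ (↭-sym prm) m

    -- the other rim edges are not the pair, since the rim has length ≥ 3
    npArc : ∀ {u v} → Adj± (arc y R' x) u v → ¬ CPair u v
    npArc {u} {v} p pr = go p (pair-cases Pxy pr)
      where
      go1 : ∀ {u v} → Adj (arc y R' x) u v → (u ≡ x × v ≡ y) ⊎ (u ≡ y × v ≡ x) → ⊥
      go1 q h with adj-interior R' q | h
      ... | inj₁ m | inj₁ (refl , refl) = x∉R' m
      ... | inj₁ m | inj₂ (refl , refl) = y∉R' m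
      ... | inj₂ (inj₁ m) | inj₁ (refl , refl) = y∉R' m
      ... | inj₂ (inj₁ m) | inj₂ (refl , refl) = x∉R' m
      ... | inj₂ (inj₂ (e , _ , _)) | _ = R'ne e
      go : Adj± (arc y R' x) u v → (u ≡ x × v ≡ y) ⊎ (u ≡ y × v ≡ x) → ⊥
      go (inj₁ q) h = go1 q h
      go (inj₂ q) (inj₁ (a , b)) = go1 q (inj₂ (b , a))
      go (inj₂ q) (inj₂ (a , b)) = go1 q (inj₁ (b , a))

    side : ∀ {w} → w ∈ rim ⊎ w ∈ J → inS w ⊎ w ∈ J
    side (inj₁ m) = inj₁ (inSW _ (there m))
    side (inj₂ m) = inj₂ m

    embJ : ∀ {u v} → Adj± (arc x J y) u v → Adj± (cycle N) u v
    embJ {u} {v} q = subst (λ l → Adj± l u v) (sym cycN) (adj±-glueʳ (y ∷ R') q)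

    toN : ∀ u v → u ∈ N → v ∈ N → R u v ≡ true → Adj± (cycle N) u v
    toN u v mu mv r with memN mu | memN mv
    ... | inj₂ ju | mv' = embJ (bypass-edge u v ju (side mv') r)
    ... | mu' | inj₂ jv = embJ (sym± (bypass-edge v u jv (side mu') (trans (Rsym v u) r)))
    ... | inj₁ ru | inj₁ rv with arcs-split y R' x [] (fw (consec±→adj± (Equivalence.to (Wheel.hole Wh u v ru rv) (≡→T (R→F r)))))
    ...   | inj₁ q = subst (λ l → Adj± l u v) (sym cycN) (adj±-glueˡ (y ∷ R') q)
    ...   | inj₂ q = ⊥-elim (R-true→¬pair r (pair-edge Pxy q))

    fromN : ∀ u v → Adj± (cycle N) u v → R u v ≡ true
    fromN u v a with arcs-split y R' x J (subst (λ l → Adj± l u v) cycN a)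
    ... | inj₂ q = from u v q
    ... | inj₁ q = F→R (T→≡ (Equivalence.from (Wheel.hole Wh u v (arcR∈ (adj±-∈₁ q)) (arcR∈ (adj±-∈₂ q)))
                          (adj±→consec± (bw (arcs-glue y R' x [] (inj₁ q)))))) (npArc q)

    zc : z ≢ c1 × z ≢ c2
    zc = pair-avoid Pxy zx zy

    cntR : count (R z) N ≡ count (F z) rim + count (R z) J
    cntR = trans (count-↭ (R z) Nperm) (trans (count-++ (R z) rim J)
             (cong (_+ count (R z) J) (count-cong (R z) (F z) rim (λ v m → sym (agreeFR z v (np v))))))
      where
      np : ∀ v → ¬ CPair z v
      np v (inj₁ (e , _)) = proj₁ zc e
      np v (inj₂ (e , _)) = proj₂ zc e

    result : Wheel R
    result = record
      { center = z ; rim = N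
      ; rimLen = subst (3 ≤_) (sym (Perm.↭-length Nperm))
                   (subst (3 ≤_) (sym (length-++ rim)) (≤-trans (Wheel.rimLen Wh) (m≤m+n (length rim) (length J))))
      ; distinct = UN
      ; hole = λ u v mu mv → mk⇔ (λ t → adj±→consec± (toN u v mu mv (T→≡ t))) (λ c → ≡→T (fromN u v (consec±→adj± c)))
      ; spokes = subst (3 ≤_) (sym cntR) (≤-trans (Wheel.spokes Wh) (m≤m+n (count (F z) rim) (count (R z) J))) }

  record ThreeSpokes (z y b c : W) (P1 P2 P3 : List W) : Set where
    field
      URim : Unique (z ∷ y ∷ P1 ++ b ∷ P2 ++ c ∷ P3)
      inSR : ∀ v → v ∈ y ∷ P1 ++ b ∷ P2 ++ c ∷ P3 → inS v
      holeF : ∀ u v → u ∈ y ∷ P1 ++ b ∷ P2 ++ c ∷ P3 → v ∈ y ∷ P1 ++ b ∷ P2 ++ c ∷ P3 → F u v ≡ true →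
              Adj± (arc y P1 b) u v ⊎ Adj± (arc b P2 c) u v ⊎ Adj± (arc c P3 y) u v
      holeB : ∀ u v → Adj± (arc y P1 b) u v ⊎ Adj± (arc b P2 c) u v ⊎ Adj± (arc c P3 y) u v → F u v ≡ true
      Fzy : F z y ≡ true
      Fzb : F z b ≡ true
      Fzc : F z c ≡ true
      spk : ∀ v → v ∈ y ∷ P1 ++ b ∷ P2 ++ c ∷ P3 → F z v ≡ true → v ≡ y ⊎ v ≡ b ⊎ v ≡ c

  rot-perm : ∀ (a b c : W) P1 P2 P3 → b ∷ P2 ++ c ∷ P3 ++ a ∷ P1 ↭ a ∷ P1 ++ b ∷ P2 ++ c ∷ P3
  rot-perm a b c P1 P2 P3 = prove 6 (B ⊕ (p2 ⊕ (C ⊕ (p3 ⊕ (A ⊕ p1)))))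
                                       (A ⊕ (p1 ⊕ (B ⊕ (p2 ⊕ (C ⊕ p3)))))
                                       ([ a ] ∷ [ b ] ∷ [ c ] ∷ P1 ∷ P2 ∷ P3 ∷ [])
    where
    open ListMonoid using (prove; var; _⊕_; Expr)
    A B C p1 p2 p3 : Expr 6
    A = var (# 0)
    B = var (# 1)
    C = var (# 2)
    p1 = var (# 3)
    p2 = var (# 4)
    p3 = var (# 5)

  -- the spokes can be rotated, so any of the three may be named first
  rotSD : ∀ {z a b c P1 P2 P3} → ThreeSpokes z a b c P1 P2 P3 → ThreeSpokes z b c a P2 P3 P1
  rotSD {z} {a} {b} {c} {P1} {P2} {P3} D = record
    { URim = unique-↭ (↭-prep z (↭-sym prm)) URim
    ; inSR = λ v m → inSR v (Perm.∈-resp-↭ prm m)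
    ; holeF = λ u v mu mv f → ro (holeF u v (Perm.∈-resp-↭ prm mu) (Perm.∈-resp-↭ prm mv) f)
    ; holeB = λ u v h → holeB u v (ro' h)
    ; Fzy = Fzb ; Fzb = Fzc ; Fzc = Fzy
    ; spk = λ v m f → rs (spk v (Perm.∈-resp-↭ prm m) f) }
    where
    open ThreeSpokes D
    prm : b ∷ P2 ++ c ∷ P3 ++ a ∷ P1 ↭ a ∷ P1 ++ b ∷ P2 ++ c ∷ P3
    prm = rot-perm a b c P1 P2 P3
    ro : ∀ {X Y Z : Set} → X ⊎ Y ⊎ Z → Y ⊎ Z ⊎ X
    ro (inj₁ x) = inj₂ (inj₂ x)
    ro (inj₂ (inj₁ y)) = inj₁ y
    ro (inj₂ (inj₂ z)) = inj₂ (inj₁ z)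
    ro' : ∀ {X Y Z : Set} → Y ⊎ Z ⊎ X → X ⊎ Y ⊎ Z
    ro' (inj₁ y) = inj₂ (inj₁ y)
    ro' (inj₂ (inj₁ z)) = inj₂ (inj₂ z)
    ro' (inj₂ (inj₂ x)) = inj₁ x
    rs : ∀ {v} → v ≡ a ⊎ v ≡ b ⊎ v ≡ c → v ≡ b ⊎ v ≡ c ⊎ v ≡ a
    rs = ro

  -- If zy = c1c2 in a three-spoke wheel of F, then in R the centre z, the
  -- spokes y, b, c, the rim and the bypass J from z to y form an ISK4 with
  -- branch vertices z, y, b, c: the six branch paths are J, zb, zc, and the
  -- three rim arcs between spokes.
  module SpokeISK4 {z y b c : W} {P1 P2 P3 : List W} (Pzy : CPair z y) (inSz : inS z)
                   (D : ThreeSpokes z y b c P1 P2 P3) where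
    open ThreeSpokes D
    rimL : List W
    rimL = y ∷ P1 ++ b ∷ P2 ++ c ∷ P3
    O : Bypass z y
    O = bypass Pzy
    open Bypass O
    open UseBypass Pzy O

    -- branch vertices z, y, b, c; branch paths zy = J, zb, zc, yb = P1,
    -- yc = P3 reversed, bc = P2 (in the order of Defs.k4edge)
    br : Fin 4 → W
    br F.zero = z
    br (F.suc F.zero) = y
    br (F.suc (F.suc F.zero)) = b
    br (F.suc (F.suc (F.suc F.zero))) = c

    ins : Fin 6 → List W
    ins F.zero = J
    ins (F.suc F.zero) = []
    ins (F.suc (F.suc F.zero)) = []
    ins (F.suc (F.suc (F.suc F.zero))) = P1
    ins (F.suc (F.suc (F.suc (F.suc F.zero)))) = reverse P3
    ins (F.suc (F.suc (F.suc (F.suc (F.suc F.zero))))) = P2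

    perm : k4verts br ins ↭ (z ∷ rimL) ++ J
    perm = ↭-trans
      (prove 8 (Z ⊕ (Y ⊕ (B ⊕ (C ⊕ (j ⊕ (ListMonoid.id ⊕ (ListMonoid.id ⊕ (p1 ⊕ (p3 ⊕ (p2 ⊕ ListMonoid.id))))))))))
                   ((Z ⊕ (Y ⊕ (p1 ⊕ (B ⊕ (p2 ⊕ (C ⊕ p3)))))) ⊕ j)
                   ([ z ] ∷ [ y ] ∷ [ b ] ∷ [ c ] ∷ J ∷ P1 ∷ reverse P3 ∷ P2 ∷ []))
      (Perm.++⁺ʳ J (↭-prep z (↭-prep y (Perm.++⁺ˡ P1 (↭-prep b (Perm.++⁺ˡ P2 (↭-prep c (Perm.↭-reverse P3))))))))
      where
      open ListMonoid using (prove; var; _⊕_; Expr)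
      Z Y B C j p1 p3 p2 : Expr 8
      Z = var (# 0)
      Y = var (# 1)
      B = var (# 2)
      C = var (# 3)
      j = var (# 4)
      p1 = var (# 5)
      p3 = var (# 6)
      p2 = var (# 7)

    mem : ∀ {w} → w ∈ k4verts br ins → w ≡ z ⊎ w ∈ rimL ⊎ w ∈ J
    mem m with ∈-++⁻ (z ∷ rimL) (Perm.∈-resp-↭ perm m)
    ... | inj₁ (here e) = inj₁ e
    ... | inj₁ (there m') = inj₂ (inj₁ m')
    ... | inj₂ m' = inj₂ (inj₂ m')

    uniqK : Unique (k4verts br ins)
    uniqK = unique-↭ (↭-sym perm) (unique-++ URim J-unique d)
      where
      d : ∀ {v} → v ∈ z ∷ rimL → v ∈ J → ⊥
      d (here refl) mj = Jnot _ mj inSz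
      d (there m) mj = Jnot _ mj (inSR _ m)

    z∉rim : z ∈ rimL → ⊥
    z∉rim = head∉tail URim

    b∈ : b ∈ rimL
    b∈ = there (∈-++⁺ʳ P1 (here refl))
    c∈ : c ∈ rimL
    c∈ = there (∈-++⁺ʳ P1 (there (∈-++⁺ʳ P2 (here refl))))
    y∈ : y ∈ rimL
    y∈ = here refl

    b≢y : b ≢ y
    b≢y refl = head∉tail (unique-tail URim) (∈-++⁺ʳ P1 (here refl))
    c≢y : c ≢ y
    c≢y refl = head∉tail (unique-tail URim) (∈-++⁺ʳ P1 (there (∈-++⁺ʳ P2 (here refl))))

    rim-not-pair : ∀ {u v} → u ∈ rimL → v ∈ rimL → ¬ CPair u v
    rim-not-pair mu mv pr with pair-cases Pzy pr
    ... | inj₁ (refl , refl) = z∉rim mu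
    ... | inj₂ (refl , refl) = z∉rim mv

    notPair-zw : ∀ {w} → w ∈ rimL → w ≢ y → ¬ CPair z w
    notPair-zw m n pr with pair-cases Pzy pr
    ... | inj₁ (_ , e) = n e
    ... | inj₂ (e , _) = z∉rim (subst (_∈ rimL) (sym e) y∈)

    arc1∈ : ∀ {w} → w ∈ arc y P1 b → w ∈ rimL
    arc1∈ m with path-∈ P1 m
    ... | inj₁ refl = y∈
    ... | inj₂ (inj₁ m') = there (∈-++⁺ˡ m')
    ... | inj₂ (inj₂ refl) = b∈
    arc2∈ : ∀ {w} → w ∈ arc b P2 c → w ∈ rimL
    arc2∈ m with path-∈ P2 m
    ... | inj₁ refl = b∈
    ... | inj₂ (inj₁ m') = there (∈-++⁺ʳ P1 (there (∈-++⁺ˡ m')))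
    ... | inj₂ (inj₂ refl) = c∈
    arc3∈ : ∀ {w} → w ∈ arc c P3 y → w ∈ rimL
    arc3∈ m with path-∈ P3 m
    ... | inj₁ refl = c∈
    ... | inj₂ (inj₁ m') = there (∈-++⁺ʳ P1 (there (∈-++⁺ʳ P2 (there m'))))
    ... | inj₂ (inj₂ refl) = y∈

    rimR : ∀ {u v} → u ∈ rimL → v ∈ rimL → Adj± (arc y P1 b) u v ⊎ Adj± (arc b P2 c) u v ⊎ Adj± (arc c P3 y) u v → R u v ≡ true
    rimR {u} {v} mu mv h = F→R (holeB u v h) (rim-not-pair mu mv)

    zR : ∀ {w} → w ∈ rimL → w ≢ y → F z w ≡ true → ∀ {u v} → Adj± (z ∷ [ w ]) u v → R u v ≡ true
    zR m n f p with edge-of-two p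
    ... | inj₁ (refl , refl) = F→R f (notPair-zw m n)
    ... | inj₂ (refl , refl) = trans (Rsym _ z) (F→R f (notPair-zw m n))

    revP3 : ∀ {u v} → Adj± (y ∷ reverse P3 ++ [ c ]) u v → Adj± (arc c P3 y) u v
    revP3 {u} {v} p = adj±-reverse⁻ {xs = arc c P3 y} (subst (λ l → Adj± l u v) (sym (reverse-path c P3 y)) p)

    revP3⁻ : ∀ {u v} → Adj± (arc c P3 y) u v → Adj± (y ∷ reverse P3 ++ [ c ]) u v
    revP3⁻ {u} {v} p = subst (λ l → Adj± l u v) (reverse-path c P3 y) (adj±-reverse p)

    fromP : ∀ u v e → Adj± (k4path br e (ins e)) u v → R u v ≡ true
    fromP u v F.zero p = from u v p
    fromP u v (F.suc F.zero) p = zR b∈ b≢y Fzb p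
    fromP u v (F.suc (F.suc F.zero)) p = zR c∈ c≢y Fzc p
    fromP u v (F.suc (F.suc (F.suc F.zero))) p = rimR (arc1∈ (adj±-∈₁ p)) (arc1∈ (adj±-∈₂ p)) (inj₁ p)
    fromP u v (F.suc (F.suc (F.suc (F.suc F.zero)))) p =
      rimR (arc3∈ (adj±-∈₁ q)) (arc3∈ (adj±-∈₂ q)) (inj₂ (inj₂ q))
      where q = revP3 p
    fromP u v (F.suc (F.suc (F.suc (F.suc (F.suc F.zero))))) p = rimR (arc2∈ (adj±-∈₁ p)) (arc2∈ (adj±-∈₂ p)) (inj₂ (inj₁ p))

    side : ∀ {w} → w ≡ z ⊎ w ∈ rimL ⊎ w ∈ J → inS w ⊎ w ∈ J
    side (inj₁ refl) = inj₁ inSz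
    side (inj₂ (inj₁ m)) = inj₁ (inSR _ m)
    side (inj₂ (inj₂ m)) = inj₂ m

    PathK : W → W → Set
    PathK u v = Σ (Fin 6) λ e → Adj± (k4path br e (ins e)) u v

    symK : ∀ {u v} → PathK u v → PathK v u
    symK (e , p) = e , sym± p

    zcase : ∀ v → v ∈ rimL → R z v ≡ true → PathK z v
    zcase v m r with spk v m (R→F r)
    ... | inj₁ refl = ⊥-elim (R-true→¬pair r Pzy)
    ... | inj₂ (inj₁ refl) = F.suc F.zero , inj₁ here
    ... | inj₂ (inj₂ refl) = F.suc (F.suc F.zero) , inj₁ here

    toP : ∀ u v → u ∈ k4verts br ins → v ∈ k4verts br ins → R u v ≡ true → PathK u v
    toP u v mu mv r with mem mu | mem mv
    ... | inj₂ (inj₂ ju) | mv' = F.zero , bypass-edge u v ju (side mv') r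
    ... | mu' | inj₂ (inj₂ jv) = F.zero , sym± (bypass-edge v u jv (side mu') (trans (Rsym v u) r))
    ... | inj₁ refl | inj₁ refl = ⊥-elim (true≢false (trans (sym r) (IsSimple.irrefl Rs z)))
    ... | inj₁ refl | inj₂ (inj₁ rv) = zcase v rv r
    ... | inj₂ (inj₁ ru) | inj₁ refl = symK (zcase u ru (trans (Rsym z u) r))
    ... | inj₂ (inj₁ ru) | inj₂ (inj₁ rv) with holeF u v ru rv (R→F r)
    ...   | inj₁ p = F.suc (F.suc (F.suc F.zero)) , p
    ...   | inj₂ (inj₁ p) = F.suc (F.suc (F.suc (F.suc (F.suc F.zero)))) , p
    ...   | inj₂ (inj₂ p) = F.suc (F.suc (F.suc (F.suc F.zero))) , revP3⁻ p

    result : ISK4 R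
    result = record
      { branch = br ; inner = ins ; distinct = uniqK
      ; exact = λ u v mu mv → mk⇔ (λ tt' → let r = toP u v mu mv (T→≡ tt') in proj₁ r , adj±→consec± (proj₂ r))
                                    (λ ec → ≡→T (fromP u v (proj₁ ec) (consec±→adj± (proj₂ ec)))) }

  -- In R
  -- the spoke zy is lost: if at least three spokes remain, the wheel
  -- survives in R; otherwise it had exactly three spokes and SpokeISK4 gives
  -- an ISK4 of R.
  module CentreOnPair (Wh : Wheel F) (inSW : ∀ v → v ∈ Wheel.center Wh ∷ Wheel.rim Wh → inS v)
                   {y : W} (Pzy : CPair (Wheel.center Wh) y) (yr : y ∈ Wheel.rim Wh) where
    z : W
    z = Wheel.center Wh
    rim : List W
    rim = Wheel.rim Wh
    UR0 : Unique (z ∷ rim)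
    UR0 = Wheel.distinct Wh
    z∉rim : z ∈ rim → ⊥
    z∉rim = head∉tail UR0
    inSz : inS z
    inSz = inSW z (here refl)

    oldHole : ∀ u v → u ∈ rim → v ∈ rim → F u v ≡ true → Adj± (cycle rim) u v
    oldHole u v mu mv f = consec±→adj± (Equivalence.to (Wheel.hole Wh u v mu mv) (≡→T f))
    oldHoleB : ∀ u v → u ∈ rim → v ∈ rim → Adj± (cycle rim) u v → F u v ≡ true
    oldHoleB u v mu mv a = T→≡ (Equivalence.from (Wheel.hole Wh u v mu mv) (adj±→consec± a))

    notPair-rim : ∀ {v} → v ∈ rim → v ≢ y → ¬ CPair z v
    notPair-rim m n pr with pair-cases Pzy pr
    ... | inj₁ (_ , e) = n e
    ... | inj₂ (e , _) = z∉rim (subst (_∈ rim) (sym e) yr)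

    npr : ∀ {u v} → u ∈ rim → v ∈ rim → ¬ CPair u v
    npr mu mv pr with pair-cases Pzy pr
    ... | inj₁ (refl , _) = z∉rim mu
    ... | inj₂ (_ , refl) = z∉rim mv

    spokes-lost : ∀ S T → rim ≡ S ++ y ∷ T → count (F z) rim ≡ suc (count (R z) rim)
    spokes-lost S T eq rewrite eq = begin
      count (F z) (S ++ y ∷ T)                  ≡⟨ count-++ (F z) S (y ∷ T) ⟩
      count (F z) S + count (F z) (y ∷ T)       ≡⟨ cong₂ _+_ on-S (count-true (F z) T (F-pair-true Pzy)) ⟩
      count (R z) S + suc (count (F z) T)       ≡⟨ cong (λ n → count (R z) S + suc n) on-T ⟩
      count (R z) S + suc (count (R z) T)       ≡⟨ +-suc (count (R z) S) (count (R z) T) ⟩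
      suc (count (R z) S + count (R z) T)       ≡⟨ cong (λ n → suc (count (R z) S + n)) (sym (count-false (R z) T (R-pair-false Pzy))) ⟩
      suc (count (R z) S + count (R z) (y ∷ T)) ≡⟨ cong suc (sym (count-++ (R z) S (y ∷ T))) ⟩
      suc (count (R z) (S ++ y ∷ T))            ∎
      where
      open ≡-Reasoning
      U : Unique (S ++ y ∷ T)
      U = subst Unique eq (unique-tail UR0)
      in-rim : ∀ {v} → v ∈ S ++ y ∷ T → v ∈ rim
      in-rim m = subst (_ ∈_) (sym eq) m
      on-S : count (F z) S ≡ count (R z) S
      on-S = count-cong (F z) (R z) S (λ v m → agreeFR z v (notPair-rim (in-rim (∈-++⁺ˡ m)) λ { refl → unique-++-disjoint S U m (here refl) }))
      on-T : count (F z) T ≡ count (R z) T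
      on-T = count-cong (F z) (R z) T (λ v m → agreeFR z v (notPair-rim (in-rim (∈-++⁺ʳ S (there m))) λ { refl → head∉tail (unique-++⁻ʳ S U) m }))

    cntF : count (F z) rim ≡ suc (count (R z) rim)
    cntF with ∈-∃++ yr
    ... | S , T , eq = spokes-lost S T eq

    wheelR : 3 ≤ count (R z) rim → Wheel R
    wheelR le = record
      { center = z ; rim = rim ; rimLen = Wheel.rimLen Wh ; distinct = UR0
      ; hole = λ u v mu mv → mk⇔ (λ t → adj±→consec± (oldHole u v mu mv (R→F (T→≡ t))))
                                  (λ c → ≡→T (F→R (oldHoleB u v mu mv (consec±→adj± c)) (npr mu mv)))
      ; spokes = le }

    module Canon (D : ThreeMarked (F z) rim) where
      open ThreeMarked D
      S' : List W
      S' = S3 ++ S0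
      rimC : List W
      rimC = a ∷ S1 ++ b ∷ S2 ++ c ∷ S'
      prm : rim ↭ rimC
      prm = ↭-trans (↭-reflexive eq)
        (prove 7 (s0 ⊕ (A ⊕ (s1 ⊕ (B ⊕ (s2 ⊕ (C ⊕ s3))))))
                     (A ⊕ (s1 ⊕ (B ⊕ (s2 ⊕ (C ⊕ (s3 ⊕ s0))))))
                     ([ a ] ∷ [ b ] ∷ [ c ] ∷ S0 ∷ S1 ∷ S2 ∷ S3 ∷ []))
        where
        open ListMonoid using (prove; var; _⊕_; Expr)
        A B C s0 s1 s2 s3 : Expr 7
        A = var (# 0)
        B = var (# 1)
        C = var (# 2)
        s0 = var (# 3)
        s1 = var (# 4)
        s2 = var (# 5)
        s3 = var (# 6)
      M : List W
      M = S1 ++ b ∷ S2 ++ c ∷ S3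
      eqA : a ∷ M ++ S0 ++ [ a ] ≡ a ∷ S1 ++ b ∷ S2 ++ c ∷ S' ++ [ a ]
      eqA = cong (a ∷_) (trans (++-assoc S1 (b ∷ S2 ++ c ∷ S3) (S0 ++ [ a ]))
              (cong (λ l → S1 ++ b ∷ l) (trans (++-assoc S2 (c ∷ S3) (S0 ++ [ a ]))
                (cong (λ l → S2 ++ c ∷ l) (sym (++-assoc S3 S0 [ a ]))))))
      eqC : rimC ++ [ a ] ≡ a ∷ S1 ++ b ∷ S2 ++ c ∷ S' ++ [ a ]
      eqC = cong (a ∷_) (trans (++-assoc S1 (b ∷ S2 ++ c ∷ S') [ a ])
              (cong (λ l → S1 ++ b ∷ l) (++-assoc S2 (c ∷ S') [ a ])))
      memC : ∀ {w} → w ∈ a ∷ S1 ++ b ∷ S2 ++ c ∷ S' ++ [ a ] → w ∈ rimC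
      memC {w} m with ∈-++⁻ rimC (subst (λ l → w ∈ l) (sym eqC) m)
      ... | inj₁ m' = m'
      ... | inj₂ (here e) = here e
      back : ∀ {w} → w ∈ rimC → w ∈ rim
      back m = Perm.∈-resp-↭ (↭-sym prm) m

      DC : ThreeSpokes z a b c S1 S2 S'
      DC = record
        { URim = unique-↭ (↭-prep z prm) UR0
        ; inSR = λ v m → inSW v (there (back m))
        ; holeF = λ u v mu mv f → arcs3-split a b c S1 S2 S'
            (subst (λ l → Adj± l u v) eqA (cycle-rotate S0 a M (subst (λ l → Adj± (cycle l) u v) eq (oldHole u v (back mu) (back mv) f))))
        ; holeB = λ u v h → let j = arcs3-glue a b c S1 S2 S' h in
            oldHoleB u v (back (memC (adj±-∈₁ j))) (back (memC (adj±-∈₂ j)))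
              (subst (λ l → Adj± (cycle l) u v) (sym eq) (cycle-rotate⁻ S0 a M (subst (λ l → Adj± l u v) (sym eqA) j)))
        ; Fzy = pa ; Fzb = pb ; Fzc = pc
        ; spk = λ v m f → only v (back m) f }

      res : ISK4 R
      res with only y yr (F-pair-true Pzy)
      ... | inj₁ refl = SpokeISK4.result Pzy inSz DC
      ... | inj₂ (inj₁ refl) = SpokeISK4.result Pzy inSz (rotSD DC)
      ... | inj₂ (inj₂ refl) = SpokeISK4.result Pzy inSz (rotSD (rotSD DC))

    result : ISK4 R ⊎ Wheel R
    result with 3 ≤? count (R z) rim
    ... | yes le = inj₂ (wheelR le)
    ... | no nle = inj₁ (Canon.res (three-marked (F z) rim c3))
      where
      c3 : count (F z) rim ≡ 3
      c3 = ≤-antisym (subst (_≤ 3) (sym cntF) (≰⇒> nle)) (Wheel.spokes Wh)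

  wheel-subdivide : (Wh : Wheel F) → (∀ v → v ∈ Wheel.center Wh ∷ Wheel.rim Wh → inS v) → ISK4 R ⊎ Wheel R
  wheel-subdivide Wh inSW with meets-pair (Wheel.center Wh ∷ Wheel.rim Wh)
  ... | inj₁ np = inj₂ (wheel-agree Wh (λ u v mu mv → sym (agreeFR u v (np u v mu mv))))
  ... | inj₂ (m1 , m2) with Wheel.center Wh ≟ c1 | Wheel.center Wh ≟ c2
  ...   | yes refl | _ = CentreOnPair.result Wh inSW (inj₁ (refl , refl)) (∈-tail c1≢c2 m2)
  ...   | no _ | yes refl = CentreOnPair.result Wh inSW (inj₂ (refl , refl)) (∈-tail (c1≢c2 ∘ sym) m1)
  ...   | no n1 | no n2 = inj₂ (on-rim (consec±→adj± (Equivalence.to (Wheel.hole Wh c1 c2 r1 r2) (≡→T Fc))))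
    where
    r1 : c1 ∈ Wheel.rim Wh
    r1 = ∈-tail n1 m1
    r2 : c2 ∈ Wheel.rim Wh
    r2 = ∈-tail n2 m2
    on-rim : Adj± (cycle (Wheel.rim Wh)) c1 c2 → Wheel R
    on-rim (inj₁ p) = SubdivideRim.result Wh inSW (inj₁ (refl , refl)) n1 n2 p
    on-rim (inj₂ p) = SubdivideRim.result Wh inSW (inj₂ (refl , refl)) n2 n1 p

-- Extending a graph on a vertex subset X of a trigraph G

finite-≟ : ∀ {A : Set} → Finite A → DecidableEquality A
finite-≟ (n , iso) = via-injection (↔⇒↣ iso) _≟F_

module Extension (G : Trigraph) (_≟_ : DecidableEquality (V G)) (X : V G → Bool) where

  Sub : Set
  Sub = Σ (V G) (λ v → T (X v))

  -- case split on equality without abstracting over u ≟ v in extend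
  same-or-distinct : ∀ (u v : V G) → u ≡ v ⊎ u ≢ v
  same-or-distinct u v with u ≟ v
  ... | yes e = inj₁ e
  ... | no n = inj₂ n

  proj₁-injective : ∀ {a b : Sub} → proj₁ a ≡ proj₁ b → a ≡ b
  proj₁-injective {u , p} {.u , q} refl = cong (u ,_) (T-irrelevant p q)

  -- E inside X, the full realization of G elsewhere; the decisions are
  -- explicit arguments so that proofs can analyse them once.
  extend′ : (u v : V G) → Dec (u ≡ v) → Dec (T (X u)) → Dec (T (X v)) → (Sub → Sub → Bool) → Bool
  extend′ u v (yes _) _ _ E = false
  extend′ u v (no _) (yes pu) (yes pv) E = E (u , pu) (v , pv)
  extend′ u v (no _) (yes pu) (no _) E = adjᵇ (θ G u v)
  extend′ u v (no _) (no _) _ E = adjᵇ (θ G u v)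

  extend : (Sub → Sub → Bool) → V G → V G → Bool
  extend E u v = extend′ u v (u ≟ v) (T? (X u)) (T? (X v)) E

  module ExtendFacts (E : Sub → Sub → Bool) (Es : IsSimple E) where

    agree′ : ∀ (a b : Sub) d₁ d₂ d₃ → extend′ (proj₁ a) (proj₁ b) d₁ d₂ d₃ E ≡ E a b
    agree′ a b (yes e) _ _ with proj₁-injective {a} {b} e
    ... | refl = sym (IsSimple.irrefl Es a)
    agree′ (u , p) (v , q) (no _) (yes pu) (yes pv) = cong₂ E (proj₁-injective refl) (proj₁-injective refl)
    agree′ (u , p) (v , q) (no _) (yes pu) (no n) = ⊥-elim (n q)
    agree′ (u , p) (v , q) (no _) (no n) _ = ⊥-elim (n p)

    agree : ∀ (a b : Sub) → extend E (proj₁ a) (proj₁ b) ≡ E a b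
    agree a b = agree′ a b (proj₁ a ≟ proj₁ b) (T? (X (proj₁ a))) (T? (X (proj₁ b)))

    irrefl′ : ∀ u d₂ d₃ → extend′ u u (u ≟ u) d₂ d₃ E ≡ false
    irrefl′ u d₂ d₃ with u ≟ u
    ... | yes _ = refl
    ... | no n = ⊥-elim (n refl)

    irrefl : ∀ u → extend E u u ≡ false
    irrefl u = irrefl′ u (T? (X u)) (T? (X u))

    sym′ : ∀ u v d₁ d₁' d₂ d₃ → extend′ u v d₁ d₂ d₃ E ≡ extend′ v u d₁' d₃ d₂ E
    sym′ u v (yes _) (yes _) d₂ d₃ = refl
    sym′ u v (yes e) (no n) d₂ d₃ = ⊥-elim (n (sym e))
    sym′ u v (no n) (yes e) d₂ d₃ = ⊥-elim (n (sym e))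
    sym′ u v (no _) (no _) (yes pu) (yes pv) = IsSimple.sym Es (u , pu) (v , pv)
    sym′ u v (no _) (no _) (yes pu) (no _) = cong adjᵇ (θ-sym G u v)
    sym′ u v (no _) (no _) (no _) (yes _) = cong adjᵇ (θ-sym G u v)
    sym′ u v (no _) (no _) (no _) (no _) = cong adjᵇ (θ-sym G u v)

    symmetric : ∀ u v → extend E u v ≡ extend E v u
    symmetric u v = sym′ u v (u ≟ v) (v ≟ u) (T? (X u)) (T? (X v))

    simple : IsSimple (extend E)
    simple = record { irrefl = irrefl ; sym = symmetric }

    value′ : ∀ u v d₁ d₂ d₃ → u ≢ v → ∀ {b} → (∀ pu pv → E (u , pu) (v , pv) ≡ b) → adjᵇ (θ G u v) ≡ b →
             extend′ u v d₁ d₂ d₃ E ≡ b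
    value′ u v (yes e) _ _ n _ _ = ⊥-elim (n e)
    value′ u v (no _) (yes pu) (yes pv) n hE hθ = hE pu pv
    value′ u v (no _) (yes pu) (no _) n hE hθ = hθ
    value′ u v (no _) (no _) _ n hE hθ = hθ

    value : ∀ u v → u ≢ v → ∀ {b} → (∀ pu pv → E (u , pu) (v , pv) ≡ b) → adjᵇ (θ G u v) ≡ b → extend E u v ≡ b
    value u v = value′ u v (u ≟ v) (T? (X u)) (T? (X v))

    embed-isk4 : ISK4 E → ISK4 (extend E)
    embed-isk4 K = Transport.isk4-map proj₁ proj₁-injective K (λ u v _ _ → agree u v)

    embed-wheel : Wheel E → Wheel (extend E)
    embed-wheel W = Transport.wheel-map proj₁ proj₁-injective W (λ u v _ _ → agree u v)

    embed-isk4-verts : (K : ISK4 E) →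
      k4verts (ISK4.branch (embed-isk4 K)) (ISK4.inner (embed-isk4 K)) ≡ map proj₁ (k4verts (ISK4.branch K) (ISK4.inner K))
    embed-isk4-verts K = Transport.k4verts-map proj₁ proj₁-injective (ISK4.branch K) (ISK4.inner K)

    embed-isk4-inside : (K : ISK4 E) → ∀ v → v ∈ k4verts (ISK4.branch (embed-isk4 K)) (ISK4.inner (embed-isk4 K)) → T (X v)
    embed-isk4-inside K v m with ∈-map⁻ proj₁ {xs = k4verts (ISK4.branch K) (ISK4.inner K)} (subst (v ∈_) (embed-isk4-verts K) m)
    ... | w , _ , refl = proj₂ w

    embed-wheel-inside : (W : Wheel E) → ∀ v → v ∈ Wheel.center (embed-wheel W) ∷ Wheel.rim (embed-wheel W) → T (X v)
    embed-wheel-inside W v m with ∈-map⁻ proj₁ {xs = Wheel.center W ∷ Wheel.rim W} m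
    ... | w , _ , refl = proj₂ w

adjᵇ-plus : ∀ {t} → t ≡ plus → adjᵇ t ≡ true
adjᵇ-plus refl = refl

adjᵇ-minus : ∀ {t} → t ≡ minus → adjᵇ t ≡ false
adjᵇ-minus refl = refl

-- Induced subtrigraphs of {ISK4, wheel}-free trigraphs are {ISK4, wheel}-free
-- (this is the clique type of good cut-partition).
induced-free : (G : Trigraph) → DecidableEquality (V G) → ISK4WheelFree G →
               (X : V G → Bool) → ISK4WheelFree (induced G X)
induced-free G _≟_ free X E Er = (λ K → proj₁ (free (extend E) realization) (embed-isk4 K))
                               , (λ W → proj₂ (free (extend E) realization) (embed-wheel W))
  where
  open Extension G _≟_ X
  open ExtendFacts E (IsRealization.simple Er)
  realization : IsRealization G (extend E)
  realization = record
    { simple = simple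
    ; strongAdj = λ u v n t → value u v n (λ pu pv → IsRealization.strongAdj Er (u , pu) (v , pv) (n ∘ cong proj₁) t) (adjᵇ-plus t)
    ; strongNon = λ u v n t → value u v n (λ pu pv → IsRealization.strongNon Er (u , pu) (v , pv) (n ∘ cong proj₁) t) (adjᵇ-minus t) }

opposite : Shore → Shore
opposite shA = shB
opposite shB = shA

C-in-block : ∀ X → T (inBlock X sC)
C-in-block shA = tt
C-in-block shB = tt

shore : Shore → Side
shore shA = sA
shore shB = sB

on-shore : ∀ X s → T (inBlock X s) → s ≢ sC → s ≡ shore X
on-shore shA sA _ _ = refl
on-shore shB sB _ _ = refl
on-shore shA sB () _
on-shore shB sA () _
on-shore _ sC _ n = ⊥-elim (n refl)

blocks-disjoint : ∀ X s → T (inBlock (opposite X) s) → s ≢ sC → ¬ T (inBlock X s)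
blocks-disjoint shA sA () _ _
blocks-disjoint shA sB _ _ ()
blocks-disjoint shB sA _ _ ()
blocks-disjoint shB sB () _ _
blocks-disjoint _ sC _ n _ = n refl

blocks-anticomplete : {G : Trigraph} (cp : CutPartition G) (X : Shore) (u v : V G) →
  T (inBlock X (part cp u)) → part cp u ≢ sC → T (inBlock (opposite X) (part cp v)) → part cp v ≢ sC → θ G u v ≡ minus
blocks-anticomplete cp shA u v pu nu pv nv = cutAB cp u v (on-shore shA _ pu nu) (on-shore shB _ pv nv)
blocks-anticomplete {G} cp shB u v pu nu pv nv =
  trans (θ-sym G u v) (cutAB cp v u (on-shore shA _ pv nv) (on-shore shB _ pu nu))

opposite-path : {G : Trigraph} {cp : CutPartition G} (st : StableType cp) (X : Shore) →
  NarrowPath G (λ v → inBlock (opposite X) (part cp v)) (StableType.c₁ st) (StableType.c₂ st)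
opposite-path st shA = StableType.pathB st
opposite-path st shB = StableType.pathA st

-- allowed s s' t is false exactly for a pair inside C that is non-adjacent
-- in G: there a realization of the stable block may have an edge that no
-- realization of G has.
allowed : Side → Side → Trit → Bool
allowed sC sC t = adjᵇ t
allowed _  _  t = true

allowed-cases : ∀ s s' t → (s ≡ sC × s' ≡ sC) ⊎ (allowed s s' t ≡ true × stableθ s s' t ≡ t)
allowed-cases sA sA t = inj₂ (refl , refl)
allowed-cases sA sB t = inj₂ (refl , refl)
allowed-cases sA sC t = inj₂ (refl , refl)
allowed-cases sB sA t = inj₂ (refl , refl)
allowed-cases sB sB t = inj₂ (refl , refl)
allowed-cases sB sC t = inj₂ (refl , refl)
allowed-cases sC sA t = inj₂ (refl , refl)
allowed-cases sC sB t = inj₂ (refl , refl)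
allowed-cases sC sC t = inj₁ (refl , refl)

allowed-sym : ∀ s s' t t' → t ≡ t' → allowed s s' t ≡ allowed s' s t'
allowed-sym sA sA t .t refl = refl
allowed-sym sA sB t .t refl = refl
allowed-sym sA sC t .t refl = refl
allowed-sym sB sA t .t refl = refl
allowed-sym sB sB t .t refl = refl
allowed-sym sB sC t .t refl = refl
allowed-sym sC sA t .t refl = refl
allowed-sym sC sB t .t refl = refl
allowed-sym sC sC t .t refl = refl

∧-adjᵇ : ∀ b t → b ∧ adjᵇ t ≡ b ⊎ (b ≡ true × t ≡ minus)
∧-adjᵇ false t = inj₁ refl
∧-adjᵇ true minus = inj₂ (refl , refl)
∧-adjᵇ true zero = inj₁ refl
∧-adjᵇ true plus = inj₁ refl

module StableBlock (G : Trigraph) (_≟_ : DecidableEquality (V G)) (cp : CutPartition G)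
                   (st : StableType cp) (X : Shore) (free : ISK4WheelFree G) where
  open StableType st

  inB : V G → Bool
  inB v = inBlock X (part cp v)

  open Extension G _≟_ inB

  CPair : V G → V G → Set
  CPair = IsPair c₁ c₂

  c₁∈C : part cp c₁ ≡ sC
  c₁∈C = Equivalence.from (isC c₁) (inj₁ refl)

  c₂∈C : part cp c₂ ≡ sC
  c₂∈C = Equivalence.from (isC c₂) (inj₂ refl)

  C-pair : ∀ u v → part cp u ≡ sC → part cp v ≡ sC → u ≢ v → CPair u v
  C-pair u v pu pv n with Equivalence.to (isC u) pu | Equivalence.to (isC v) pv
  ... | inj₁ refl | inj₁ refl = ⊥-elim (n refl)
  ... | inj₁ refl | inj₂ refl = inj₁ (refl , refl)
  ... | inj₂ refl | inj₁ refl = inj₂ (refl , refl)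
  ... | inj₂ refl | inj₂ refl = ⊥-elim (n refl)

  pair-not-plus : ∀ {u v} → CPair u v → θ G u v ≢ plus
  pair-not-plus (inj₁ (refl , refl)) e = subst (T ∘ antiᵇ) e stable
  pair-not-plus (inj₂ (refl , refl)) e = subst (T ∘ antiᵇ) (trans (θ-sym G c₁ c₂) e) stable

  outside⇒not-C : ∀ v → ¬ T (inB v) → part cp v ≢ sC
  outside⇒not-C v n e = n (subst (λ s → T (inBlock X s)) (sym e) (C-in-block X))

  open NarrowPath (opposite-path st X) renaming (inner to I; distinct to Q-distinct; exact to Q-exact; inX to Q-inX)

  Q-unique : Unique (c₁ ∷ I ++ [ c₂ ])
  Q-unique = subst Unique ends Q-distinct

  Q-verts : ∀ {w} → w ∈ c₁ ∷ I ++ [ c₂ ] → w ∈ verts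
  Q-verts {w} m = subst (w ∈_) (sym ends) m

  I-not-C : ∀ {p} → p ∈ I → part cp p ≢ sC
  I-not-C {p} m e with Equivalence.to (isC p) e
  ... | inj₁ refl = head∉tail Q-unique (∈-++⁺ˡ m)
  ... | inj₂ refl = unique-++-disjoint I (unique-tail Q-unique) m (here refl)

  I-outside : ∀ p → p ∈ I → ¬ T (inB p)
  I-outside p m = blocks-disjoint X (part cp p) (Q-inX p (Q-verts (there (∈-++⁺ˡ m)))) (I-not-C m)

  module Realization (E : Sub → Sub → Bool) (Er : IsRealization (stableBlock G cp X) E) where
    open ExtendFacts E (IsRealization.simple Er)

    R : V G → V G → Bool
    R u v = extend E u v ∧ allowed (part cp u) (part cp v) (θ G u v)

    R-simple : IsSimple R
    R-simple = record
      { irrefl = λ u → cong (_∧ allowed (part cp u) (part cp u) (θ G u u)) (irrefl u)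
      ; sym = λ u v → cong₂ _∧_ (symmetric u v) (allowed-sym (part cp u) (part cp v) _ _ (θ-sym G u v)) }

    R-allowed : ∀ {u v} → allowed (part cp u) (part cp v) (θ G u v) ≡ true → R u v ≡ extend E u v
    R-allowed {u} {v} ok = trans (cong (extend E u v ∧_) ok) (∧-identityʳ _)

    realization : IsRealization G R
    realization = record { simple = R-simple ; strongAdj = strong-adj ; strongNon = strong-non }
      where
      strong-adj : ∀ u v → u ≢ v → θ G u v ≡ plus → R u v ≡ true
      strong-adj u v n t with allowed-cases (part cp u) (part cp v) (θ G u v)
      ... | inj₁ (pu , pv) = ⊥-elim (pair-not-plus (C-pair u v pu pv n) t)
      ... | inj₂ (ok , same) = trans (R-allowed ok)
            (value u v n (λ pu pv → IsRealization.strongAdj Er (u , pu) (v , pv) (n ∘ cong proj₁) (trans same t)) (adjᵇ-plus t))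
      strong-non : ∀ u v → u ≢ v → θ G u v ≡ minus → R u v ≡ false
      strong-non u v n t with allowed-cases (part cp u) (part cp v) (θ G u v)
      ... | inj₁ (pu , pv) =
            trans (cong₂ (λ s s' → extend E u v ∧ allowed s s' (θ G u v)) pu pv) (trans (cong (extend E u v ∧_) (adjᵇ-minus t)) (∧-zeroʳ _))
      ... | inj₂ (ok , same) = trans (R-allowed ok)
            (value u v n (λ pu pv → IsRealization.strongNon Er (u , pu) (v , pv) (n ∘ cong proj₁) (trans same t)) (adjᵇ-minus t))

    agree-off-pair : ∀ u v → ¬ CPair u v → extend E u v ≡ R u v
    agree-off-pair u v np with allowed-cases (part cp u) (part cp v) (θ G u v)
    ... | inj₂ (ok , _) = sym (R-allowed ok)
    ... | inj₁ (pu , pv) with same-or-distinct u v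
    ...   | inj₁ refl = trans (irrefl u) (sym (IsSimple.irrefl R-simple u))
    ...   | inj₂ n = ⊥-elim (np (C-pair u v pu pv n))

    R-pair : R c₁ c₂ ≡ extend E c₁ c₂ ∧ adjᵇ (θ G c₁ c₂)
    R-pair = cong₂ (λ s s' → extend E c₁ c₂ ∧ allowed s s' (θ G c₁ c₂)) c₁∈C c₂∈C

    agree-everywhere : extend E c₁ c₂ ≡ R c₁ c₂ → ∀ u v → R u v ≡ extend E u v
    agree-everywhere same u v with same-or-distinct u v
    ... | inj₁ refl = trans (IsSimple.irrefl R-simple u) (sym (irrefl u))
    ... | inj₂ n with allowed-cases (part cp u) (part cp v) (θ G u v)
    ...   | inj₂ (ok , _) = R-allowed ok
    ...   | inj₁ (pu , pv) with C-pair u v pu pv n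
    ...     | inj₁ (refl , refl) = sym same
    ...     | inj₂ (refl , refl) = trans (IsSimple.sym R-simple c₂ c₁) (trans (sym same) (symmetric c₁ c₂))

    module Bypassed (Fc : extend E c₁ c₂ ≡ true) (θc : θ G c₁ c₂ ≡ minus) where

      Rc : R c₁ c₂ ≡ false
      Rc = trans R-pair (cong₂ _∧_ Fc (adjᵇ-minus θc))

      allowed-outside : ∀ u v → ¬ T (inB u) → allowed (part cp u) (part cp v) (θ G u v) ≡ true
      allowed-outside u v nu with allowed-cases (part cp u) (part cp v) (θ G u v)
      ... | inj₁ (pu , _) = ⊥-elim (outside⇒not-C u nu pu)
      ... | inj₂ (ok , _) = ok

      R-outside : ∀ u v → ¬ T (inB u) → u ≢ v → R u v ≡ adjᵇ (θ G u v)
      R-outside u v nu n = trans (R-allowed (allowed-outside u v nu)) (value u v n (λ pu _ → ⊥-elim (nu pu)) refl)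

      not-C : ∀ {v} → v ≢ c₁ → v ≢ c₂ → part cp v ≢ sC
      not-C {v} n₁ n₂ e with Equivalence.to (isC v) e
      ... | inj₁ q = n₁ q
      ... | inj₂ q = n₂ q

      I-anti : ∀ p v → p ∈ I → T (inB v) → v ≢ c₁ → v ≢ c₂ → R p v ≡ false
      I-anti p v m pv n₁ n₂ = trans (R-outside p v (I-outside p m) p≢v) (adjᵇ-minus (trans (θ-sym G p v) θvp))
        where
        p≢v : p ≢ v
        p≢v refl = I-outside p m pv
        θvp : θ G v p ≡ minus
        θvp = blocks-anticomplete cp X v p pv (not-C n₁ n₂) (Q-inX p (Q-verts (there (∈-++⁺ˡ m)))) (I-not-C m)

      R-on-Q : ∀ u v → u ≢ v → u ∈ c₁ ∷ I ++ [ c₂ ] → v ∈ c₁ ∷ I ++ [ c₂ ] → R u v ≡ adjᵇ (θ G u v)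
      R-on-Q u v n mu mv with path-∈ I mu | path-∈ I mv
      ... | inj₂ (inj₁ m) | _ = R-outside u v (I-outside u m) n
      ... | _ | inj₂ (inj₁ m) =
            trans (IsSimple.sym R-simple u v) (trans (R-outside v u (I-outside v m) (n ∘ sym)) (cong adjᵇ (θ-sym G v u)))
      ... | inj₁ refl | inj₁ refl = ⊥-elim (n refl)
      ... | inj₂ (inj₂ refl) | inj₂ (inj₂ refl) = ⊥-elim (n refl)
      ... | inj₁ refl | inj₂ (inj₂ refl) = trans Rc (sym (adjᵇ-minus θc))
      ... | inj₂ (inj₂ refl) | inj₁ refl =
            trans (IsSimple.sym R-simple c₂ c₁) (trans Rc (sym (adjᵇ-minus (trans (θ-sym G c₂ c₁) θc))))

      Q-to : ∀ u v → u ∈ c₁ ∷ I ++ [ c₂ ] → v ∈ c₁ ∷ I ++ [ c₂ ] → R u v ≡ true → Adj± (c₁ ∷ I ++ [ c₂ ]) u v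
      Q-to u v mu mv r = subst (λ l → Adj± l u v) ends
        (consec±→adj± (Equivalence.to (Q-exact u v (Q-verts mu) (Q-verts mv)) (≡→T (trans (sym (R-on-Q u v n mu mv)) r))))
        where
        n : u ≢ v
        n refl = true≢false (trans (sym r) (IsSimple.irrefl R-simple u))

      Q-from : ∀ u v → Adj± (c₁ ∷ I ++ [ c₂ ]) u v → R u v ≡ true
      Q-from u v a = trans (R-on-Q u v (adj±-distinct Q-unique a) (adj±-∈₁ a) (adj±-∈₂ a))
        (T→≡ (Equivalence.from (Q-exact u v (Q-verts (adj±-∈₁ a)) (Q-verts (adj±-∈₂ a)))
                                (adj±→consec± (subst (λ l → Adj± l u v) (sym ends) a))))

      open EdgeSubdivision _≟_ (extend E) R simple R-simple c₁ c₂ c₁≢c₂ Fc Rc agree-off-pair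
             (T ∘ inB) I Q-unique I-outside I-anti Q-to Q-from public

    no-isk4 : ¬ ISK4 E
    no-isk4 K with ∧-adjᵇ (extend E c₁ c₂) (θ G c₁ c₂)
    ... | inj₁ same = proj₁ (free R realization)
          (isk4-agree (embed-isk4 K) (λ u v _ _ → agree-everywhere (sym (trans R-pair same)) u v))
    ... | inj₂ (Fc , θc) = proj₁ (free R realization) (Bypassed.isk4-subdivide Fc θc (embed-isk4 K) (embed-isk4-inside K))

    no-wheel : ¬ Wheel E
    no-wheel W with ∧-adjᵇ (extend E c₁ c₂) (θ G c₁ c₂)
    ... | inj₁ same = proj₂ (free R realization)
          (wheel-agree (embed-wheel W) (λ u v _ _ → agree-everywhere (sym (trans R-pair same)) u v))
    ... | inj₂ (Fc , θc) with Bypassed.wheel-subdivide Fc θc (embed-wheel W) (embed-wheel-inside W)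
    ...   | inj₁ K = proj₁ (free R realization) K
    ...   | inj₂ W' = proj₂ (free R realization) W'

  stable-block-free : ISK4WheelFree (stableBlock G cp X)
  stable-block-free E Er = Realization.no-isk4 E Er , Realization.no-wheel E Er

proposition4p4 : (G : Trigraph) → Finite (V G) → ISK4WheelFree G →
                 (P : GoodCutPartition G) →
                 ISK4WheelFree (block G P shA) × ISK4WheelFree (block G P shB)
proposition4p4 G fin free P = block-free shA , block-free shB
  where
  _≟_ : DecidableEquality (V G)
  _≟_ = finite-≟ fin
  block-free : ∀ X → ISK4WheelFree (block G P X)
  block-free X with type P
  ... | inj₁ _ = induced-free G _≟_ free (λ v → inBlock X (part (cut P) v))
  ... | inj₂ st = StableBlock.stable-block-free G _≟_ (cut P) st X free
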